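{- Let $T$ be a valid set such that there is a unique pair $(\alpha',\beta')\in T$ with $\gamma_{\alpha',\beta'}=\Gamma_T$. Then $n^{ -1}|\mathcal{E}_T(\alpha',\beta')\cap[n]|\to1$ as $n\to\infty$; that is, almost every $n$ has $\mathcal{S}_T(n)=\{(\alpha',\beta')\}$.
   Context: For relatively prime positive integers $\alpha,\beta$ and positive integers $a_1,a_2$, the $(\alpha,\beta)$-walk $w^{\alpha,\beta}_k(a_1,a_2)$ is the sequence with $w_1=a_1$, $w_2=a_2$, $w_{k+2}=\alpha w_{k+1}+\beta w_k$ for $k\ge1$. For a positive integer $n$, $s^{\alpha,\beta}(n;a_1,a_2)$ is the (largest) index $s$ with $w^{\alpha,\beta}_s(a_1,a_2)=n$ ($-\infty$ if none), and $s^{\alpha,\beta}(n)=\max_{a_1,a_2\ge1}s^{\alpha,\beta}(n;a_1,a_2)$. Let $\gamma_{\alpha,\beta}=\frac12(\alpha+\sqrt{\alpha^2+4\beta})$. A set $T$ is valid if $T\subseteq\{(\alpha,\beta):\alpha,\beta\ge1,\ \gcd(\alpha,\beta)=1\}$. For valid $T$: $s^*_T(n)=\max_{(\alpha,\beta)\in T}s^{\alpha,\beta}(n)$, $\mathcal{S}_T(n)=\{(\alpha,\beta)\in T:s^{\alpha,\beta}(n)=s^*_T(n)\}$, $\Gamma_T=\min\{\gamma_{\alpha,\beta}:(\alpha,\beta)\in T\}$, and $\mathcal{E}_T(\alpha,\beta)=\{n\ge1:\mathcal{S}_T(n)=\{(\alpha,\beta)\}\}$. $[n]=\{1,\dots,n\}$.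 -}

module Defs where

open import Level using (0ℓ)
open import Data.Nat using (ℕ; zero; suc; _+_; _*_; _∸_; _≤_; _<_)
open import Data.Nat.Coprimality using (Coprime)
open import Data.Product using (Σ; _×_; _,_; ∃)
open import Data.List using (List; length)
open import Data.List.Relation.Unary.All using (All)
open import Data.List.Relation.Unary.Unique.Propositional using (Unique)
open import Relation.Binary.PropositionalEquality using (_≡_; _≢_)
open import Relation.Unary using (Pred)

walk₀ : ℕ → ℕ → ℕ → ℕ → ℕ → ℕ
walk₀ α β a₁ a₂ zero = a₁
walk₀ α β a₁ a₂ (suc zero) = a₂
walk₀ α β a₁ a₂ (suc (suc k)) = α * walk₀ α β a₁ a₂ (suc k) + β * walk₀ α β a₁ a₂ k

-- the (α,β)-walk w^{α,β}_k(a₁,a₂), 1-indexed (meaningful for k ≥ 1)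
walk : ℕ → ℕ → ℕ → ℕ → ℕ → ℕ
walk α β a₁ a₂ k = walk₀ α β a₁ a₂ (k ∸ 1)

Occurs : ℕ → ℕ → ℕ → ℕ → Set
Occurs α β n s = Σ ℕ λ a₁ → Σ ℕ λ a₂ →
  (1 ≤ a₁) × (1 ≤ a₂) × (1 ≤ s) × (walk α β a₁ a₂ s ≡ n)

IsS : ℕ → ℕ → ℕ → ℕ → Set
IsS α β n s = Occurs α β n s × (∀ t → Occurs α β n t → t ≤ s)

Pair : Set
Pair = ℕ × ℕ

Valid : Pred Pair 0ℓ → Set
Valid T = ∀ α β → T (α , β) → (1 ≤ α) × (1 ≤ β) × Coprime α β

-- γ_{α,β} < γ_{α',β'} for the positive roots γ of x² - αx - β:
-- there is a rational a/b (b ≥ 1) strictly between them.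
-- (For q = a/b > 0: γ_{α,β} < q  iff  q² > αq + β.)
GammaLt : Pair → Pair → Set
GammaLt (α , β) (α' , β') = Σ ℕ λ a → Σ ℕ λ b →
  (1 ≤ b) × (α * a * b + β * b * b < a * a) × (a * a < α' * a * b + β' * b * b)

-- n ∈ 𝓔_T(p), i.e. 𝓢_T(n) = {p}: p ∈ T attains s^*_T(n) and every other
-- pair of T has strictly smaller s-value.
InE : Pred Pair 0ℓ → Pair → ℕ → Set
InE T (α , β) n = T (α , β) × (Σ ℕ λ s → IsS α β n s ×
  (∀ α₁ β₁ → T (α₁ , β₁) → (α₁ , β₁) ≢ (α , β) → ∀ t → IsS α₁ β₁ n t → t < s))

-- n⁻¹ |E ∩ [n]| → 1 : for every k, eventually |E ∩ [n]| ≥ (1 - 1/(k+1)) n,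
-- witnessed by a duplicate-free list of elements of E ∩ [n].
DensityOne : (ℕ → Set) → Set
DensityOne E = ∀ k → Σ ℕ λ N → ∀ n → N ≤ n →
  Σ (List ℕ) λ xs → Unique xs × All (λ m → (1 ≤ m) × (m ≤ n) × E m) xs ×
    (suc k * n ≤ n + suc k * length xs)

-- Let U and V be the walks started at (1,0) and (0,1), so every walk is a₁ U + a₂ V.  If
-- m > U_j V_j then, U_j and V_j being coprime, m is a positive combination of them (Frobenius),
-- i.e. m lies on a walk of (α',β') at index j + 1.  Conversely, if m occurs on an (α,β)-walk
-- at an index > j it is a positive combination of U^{α,β}_j and V^{α,β}_j, and at most
-- n² / (U_j V_j) numbers below n are.  Taking j with U'_j V'_j ≈ n / 2k, it remains to show
-- that U_j V_j ≥ C n for all other (α,β) ∈ T at once.  Since V grows like γ^j this follows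
-- from one rational a / b with γ_{α',β'} < a / b < γ_{α,β} for all such pairs: inside a
-- bounded box of parameters it is found by a Diophantine gap argument, outside the box
-- γ_{α,β} is large anyway.  Throughout, a / b ≥ γ_{α,β} is written α a b + β b b ≤ a a.

module Submission where

open import Defs
open import Level using (0ℓ)
open import Data.Nat
open import Data.Nat.Properties
open import Data.Nat.DivMod using (_/_; _%_; m≡m%n+[m/n]*n; m%n<n; m*n/n≡m; /-monoˡ-≤; m/n*n≤m)
open import Data.Nat.Divisibility using (_∣_; ∣-trans; m∣m*n; ∣m+n∣m⇒∣n)
open import Data.Nat.Coprimality using (Coprime; coprime-divisor; coprime-Bézout; 1-coprimeTo)
  renaming (sym to coprime-sym)
open import Data.Nat.GCD using (module Bézout)
open import Data.Nat.Tactic.RingSolver using (solve-∀)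
open import Data.Product using (Σ; _×_; _,_; proj₁; proj₂)
open import Data.Sum using (_⊎_; inj₁; inj₂)
open import Data.Empty using (⊥; ⊥-elim)
open import Data.List using (List; []; _∷_; _++_; length; filter; map; cartesianProduct)
open import Data.List.Properties using (length-map; length-++)
open import Data.List.Membership.Propositional using (_∈_; lose)
open import Data.List.Membership.Propositional.Properties using (∈-++⁺ˡ; ∈-++⁺ʳ; ∈-map⁺; ∈-filter⁻; ∈-cartesianProduct⁺)
open import Data.List.Relation.Unary.Any using (Any; here; there; any?)
open import Data.List.Relation.Unary.All using (All; []; _∷_; tabulate)
open import Data.List.Relation.Unary.Unique.Propositional using (Unique)
open import Data.List.Relation.Unary.Unique.Propositional.Properties using (filter⁺)
open import Data.List.Relation.Unary.AllPairs using ([]; _∷_)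
open import Relation.Binary.PropositionalEquality using (_≡_; _≢_; refl; sym; trans; cong; cong₂; subst; subst₂; module ≡-Reasoning)
open import Relation.Binary.Definitions using (tri<; tri≈; tri>)
open import Relation.Nullary using (¬_; Dec; yes; no)
open import Relation.Nullary.Decidable using (_×-dec_; decidable-stable)
open import Relation.Unary using (Pred; Decidable; _∪_)
open import Relation.Unary.Properties using (_∪?_; ∁?)
open import Function using (_∘_)

U V : ℕ → ℕ → ℕ → ℕ
U α β = walk₀ α β 1 0
V α β = walk₀ α β 0 1

walk₀-suc : ∀ α β a₁ a₂ i → walk₀ α β a₁ a₂ (suc i) ≡ walk₀ α β a₂ (α * a₂ + β * a₁) i
walk₀-suc α β a₁ a₂ zero = refl
walk₀-suc α β a₁ a₂ (suc zero) = refl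
walk₀-suc α β a₁ a₂ (suc (suc i))
  rewrite walk₀-suc α β a₁ a₂ (suc i) | walk₀-suc α β a₁ a₂ i = refl

walk₀-+ : ∀ α β a₁ a₂ d i →
  walk₀ α β a₁ a₂ (d + i) ≡ walk₀ α β (walk₀ α β a₁ a₂ d) (walk₀ α β a₁ a₂ (suc d)) i
walk₀-+ α β a₁ a₂ zero i = refl
walk₀-+ α β a₁ a₂ (suc d) i = begin
  walk₀ α β a₁ a₂ (suc d + i)   ≡⟨ walk₀-suc α β a₁ a₂ (d + i) ⟩
  walk₀ α β a₂ a₃ (d + i)       ≡⟨ walk₀-+ α β a₂ a₃ d i ⟩
  walk₀ α β (walk₀ α β a₂ a₃ d) (walk₀ α β a₂ a₃ (suc d)) i
    ≡⟨ sym (cong₂ (λ u v → walk₀ α β u v i) (walk₀-suc α β a₁ a₂ d) (walk₀-suc α β a₁ a₂ (suc d))) ⟩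
  walk₀ α β (walk₀ α β a₁ a₂ (suc d)) (walk₀ α β a₁ a₂ (suc (suc d))) i ∎
  where
  open ≡-Reasoning
  a₃ = α * a₂ + β * a₁

walk₀≡U+V : ∀ α β a₁ a₂ i → walk₀ α β a₁ a₂ i ≡ a₁ * U α β i + a₂ * V α β i
walk₀≡U+V α β a₁ a₂ zero = sym (trans (cong₂ _+_ (*-identityʳ a₁) (*-zeroʳ a₂)) (+-identityʳ a₁))
walk₀≡U+V α β a₁ a₂ (suc zero) = sym (cong₂ _+_ (*-zeroʳ a₁) (*-identityʳ a₂))
walk₀≡U+V α β a₁ a₂ (suc (suc i))
  rewrite walk₀≡U+V α β a₁ a₂ (suc i) | walk₀≡U+V α β a₁ a₂ i =
  regroup α β a₁ a₂ (U α β (suc i)) (V α β (suc i)) (U α β i) (V α β i)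
  where
  regroup : ∀ α β a₁ a₂ u₁ v₁ u₀ v₀ → α * (a₁ * u₁ + a₂ * v₁) + β * (a₁ * u₀ + a₂ * v₀)
            ≡ a₁ * (α * u₁ + β * u₀) + a₂ * (α * v₁ + β * v₀)
  regroup = solve-∀

U-suc : ∀ α β i → U α β (suc i) ≡ β * V α β i
U-suc α β i = begin
  U α β (suc i)                                   ≡⟨ walk₀-suc α β 1 0 i ⟩
  walk₀ α β 0 (α * 0 + β * 1) i                   ≡⟨ walk₀≡U+V α β 0 _ i ⟩
  0 * U α β i + (α * 0 + β * 1) * V α β i          ≡⟨ simplify α β (U α β i) (V α β i) ⟩
  β * V α β i                                     ∎
  where
  open ≡-Reasoning
  simplify : ∀ α β u v → 0 * u + (α * 0 + β * 1) * v ≡ β * v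
  simplify = solve-∀

walk₀-mono : ∀ {α β a₁ a₂} → 1 ≤ α → ∀ i → walk₀ α β a₁ a₂ (suc i) ≤ walk₀ α β a₁ a₂ (suc (suc i))
walk₀-mono {α} 1≤α i = ≤-trans (m≤n*m _ α {{>-nonZero 1≤α}}) (m≤m+n _ _)

walk₀-≥-a₂ : ∀ {α β a₁ a₂} → 1 ≤ α → ∀ i → a₂ ≤ walk₀ α β a₁ a₂ (suc i)
walk₀-≥-a₂ 1≤α zero = ≤-refl
walk₀-≥-a₂ 1≤α (suc i) = ≤-trans (walk₀-≥-a₂ 1≤α i) (walk₀-mono 1≤α i)

walk₀-≥-a₁ : ∀ {α β a₁ a₂} → 1 ≤ α → 1 ≤ β → ∀ i → a₁ ≤ walk₀ α β a₁ a₂ (suc (suc i))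
walk₀-≥-a₁ {β = β} {a₁} 1≤α 1≤β zero = ≤-trans (m≤n*m a₁ β {{>-nonZero 1≤β}}) (m≤n+m _ _)
walk₀-≥-a₁ 1≤α 1≤β (suc i) = ≤-trans (walk₀-≥-a₁ 1≤α 1≤β i) (walk₀-mono 1≤α (suc i))

walk₀-pos : ∀ {α β a₁ a₂} → 1 ≤ α → 1 ≤ a₁ → 1 ≤ a₂ → ∀ i → 1 ≤ walk₀ α β a₁ a₂ i
walk₀-pos 1≤α 1≤a₁ 1≤a₂ zero = 1≤a₁
walk₀-pos 1≤α 1≤a₁ 1≤a₂ (suc zero) = 1≤a₂
walk₀-pos 1≤α 1≤a₁ 1≤a₂ (suc (suc i)) =
  ≤-trans (walk₀-pos 1≤α 1≤a₁ 1≤a₂ (suc i)) (walk₀-mono 1≤α i)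

index≤walk₀ : ∀ {α β a₁ a₂} → 1 ≤ α → 1 ≤ β → 1 ≤ a₁ → 1 ≤ a₂ → ∀ i → i ≤ walk₀ α β a₁ a₂ i
index≤walk₀ 1≤α 1≤β 1≤a₁ 1≤a₂ zero = z≤n
index≤walk₀ 1≤α 1≤β 1≤a₁ 1≤a₂ (suc zero) = 1≤a₂
index≤walk₀ {α} {β} {a₁} {a₂} 1≤α 1≤β 1≤a₁ 1≤a₂ (suc (suc i)) = begin
  suc (suc i)             ≡⟨ +-comm 1 (suc i) ⟩
  suc i + 1               ≤⟨ +-mono-≤ (index≤walk₀ 1≤α 1≤β 1≤a₁ 1≤a₂ (suc i)) (walk₀-pos 1≤α 1≤a₁ 1≤a₂ i) ⟩
  w (suc i) + w i         ≤⟨ +-mono-≤ (m≤n*m (w (suc i)) α {{>-nonZero 1≤α}}) (m≤n*m (w i) β {{>-nonZero 1≤β}}) ⟩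
  α * w (suc i) + β * w i ∎
  where
  open ≤-Reasoning
  w = walk₀ α β a₁ a₂

V-pos : ∀ {α β j} → 1 ≤ α → 1 ≤ j → 1 ≤ V α β j
V-pos {α} {β} {suc i} 1≤α _ = subst (1 ≤_) (sym (walk₀-suc α β 0 1 i))
  (walk₀-pos 1≤α ≤-refl (≤-trans 1≤α (≤-trans (m≤m*n α 1) (m≤m+n _ _))) i)

U-pos : ∀ {α β j} → 1 ≤ α → 1 ≤ β → 2 ≤ j → 1 ≤ U α β j
U-pos {j = suc zero} _ _ (s≤s ())
U-pos {α} {β} {suc (suc i)} 1≤α 1≤β _ =
  subst (1 ≤_) (sym (U-suc α β (suc i))) (*-mono-≤ 1≤β (V-pos {β = β} {j = suc i} 1≤α (s≤s z≤n)))

Representable : ℕ → ℕ → ℕ → Set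
Representable u v m = Σ ℕ λ x → Σ ℕ λ y → (1 ≤ x) × (1 ≤ y) × (x * u + y * v ≡ m)

representable-swap : ∀ {u v m} → Representable u v m → Representable v u m
representable-swap {u} {v} (x , y , 1≤x , 1≤y , eq) = y , x , 1≤y , 1≤x , trans (+-comm (y * v) (x * u)) eq

occurs⇒representable : ∀ {α β m t} j → 1 ≤ α → Occurs α β m t → suc j ≤ t →
  Representable (U α β j) (V α β j) m
occurs⇒representable {α} {β} {m} {suc k} j 1≤α (a₁ , a₂ , 1≤a₁ , 1≤a₂ , _ , w≡m) (s≤s j≤k) =
  w d , w (suc d) , walk₀-pos 1≤α 1≤a₁ 1≤a₂ d , walk₀-pos 1≤α 1≤a₁ 1≤a₂ (suc d) , (begin
    w d * U α β j + w (suc d) * V α β j ≡⟨ walk₀≡U+V α β (w d) (w (suc d)) j ⟨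
    walk₀ α β (w d) (w (suc d)) j       ≡⟨ walk₀-+ α β a₁ a₂ d j ⟨
    w (d + j)                           ≡⟨ cong w (m∸n+n≡m j≤k) ⟩
    w k                                 ≡⟨ w≡m ⟩
    m                                   ∎)
  where
  open ≡-Reasoning
  w = walk₀ α β a₁ a₂
  d = k ∸ j

-- x is the residue of m u modulo B, shifted into [1, B]; then x A ≡ m (mod B),
-- and the quotient y = (m - x A) / B is positive because x A ≤ A B < m.
representable-of-Bézout : ∀ A B u v m → u * A ≡ 1 + v * B → 1 ≤ B → A * B < m →
  Representable A B m
representable-of-Bézout A (suc b) zero v m () 1≤B AB<m
representable-of-Bézout A (suc b) (suc u) v (suc m) uA≡1+vB 1≤B AB<m =
  x , y , s≤s z≤n , m<n⇒0<n∸m mv<qA , xA+yB≡m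
  where
  open ≡-Reasoning
  B = suc b
  t = suc m * suc u
  x = suc ((t ∸ 1) % B)
  q = (t ∸ 1) / B
  y = q * A ∸ suc m * v
  t≡x+qB : t ≡ x + q * B
  t≡x+qB = cong suc (m≡m%n+[m/n]*n (t ∸ 1) B)
  xA+qAB≡m+mvB : x * A + q * A * B ≡ suc m + suc m * v * B
  xA+qAB≡m+mvB = begin
    x * A + q * A * B       ≡⟨ regroup x q A B ⟩
    (x + q * B) * A         ≡⟨ cong (_* A) t≡x+qB ⟨
    t * A                   ≡⟨ *-assoc (suc m) (suc u) A ⟩
    suc m * (suc u * A)     ≡⟨ cong (suc m *_) uA≡1+vB ⟩
    suc m * (1 + v * B)     ≡⟨ expand (suc m) v B ⟩
    suc m + suc m * v * B   ∎
    where
    regroup : ∀ x q A B → x * A + q * A * B ≡ (x + q * B) * A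
    regroup = solve-∀
    expand : ∀ m v B → m * (1 + v * B) ≡ m + m * v * B
    expand = solve-∀
  xA<m : x * A < suc m
  xA<m = ≤-<-trans (≤-trans (*-monoˡ-≤ A (m%n<n (t ∸ 1) B)) (≤-reflexive (*-comm B A))) AB<m
  mv<qA : suc m * v < q * A
  mv<qA = *-cancelʳ-< B _ _ (+-cancelˡ-< (suc m) _ _
    (subst (_< suc m + q * A * B) xA+qAB≡m+mvB (+-monoˡ-< (q * A * B) xA<m)))
  xA+yB≡m : x * A + y * B ≡ suc m
  xA+yB≡m = +-cancelʳ-≡ (suc m * v * B) _ _ (begin
    x * A + y * B + suc m * v * B     ≡⟨ +-assoc (x * A) _ _ ⟩
    x * A + (y * B + suc m * v * B)   ≡⟨ cong (x * A +_) (*-distribʳ-+ B y (suc m * v)) ⟨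
    x * A + (y + suc m * v) * B       ≡⟨ cong (λ z → x * A + z * B) (m∸n+n≡m (<⇒≤ mv<qA)) ⟩
    x * A + q * A * B                 ≡⟨ xA+qAB≡m+mvB ⟩
    suc m + suc m * v * B             ∎)

frobenius : ∀ {A B m} → Coprime A B → 1 ≤ A → 1 ≤ B → A * B < m → Representable A B m
frobenius {A} {B} {m} A⊥B 1≤A 1≤B AB<m with coprime-Bézout A⊥B
... | Bézout.+- x y eq = representable-of-Bézout A B x y m (sym eq) 1≤B AB<m
... | Bézout.-+ x y eq = representable-swap
  (representable-of-Bézout B A y x m (sym eq) 1≤A (subst (_< m) (*-comm A B) AB<m))

coprime-+-* : ∀ {n x} k → Coprime n x → Coprime n (x + n * k)
coprime-+-* {n} {x} k n⊥x {d} (d∣n , d∣x+nk) =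
  n⊥x (d∣n , ∣m+n∣m⇒∣n (subst (d ∣_) (+-comm x (n * k)) d∣x+nk) (∣-trans d∣n (m∣m*n k)))

coprime-* : ∀ {n a b} → Coprime n a → Coprime n b → Coprime n (a * b)
coprime-* n⊥a n⊥b (d∣n , d∣ab) = n⊥b (d∣n , coprime-divisor (λ (e∣d , e∣a) → n⊥a (∣-trans e∣d d∣n , e∣a)) d∣ab)

coprime-β-V : ∀ {α β} → Coprime α β → ∀ i → Coprime β (V α β (suc i))
coprime-β-V {α} {β} α⊥β zero = coprime-sym (1-coprimeTo β)
coprime-β-V {α} {β} α⊥β (suc i) =
  coprime-+-* (V α β i) (coprime-* (coprime-sym α⊥β) (coprime-β-V α⊥β i))

coprime-V-V : ∀ {α β} → Coprime α β → ∀ i → Coprime (V α β i) (V α β (suc i))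
coprime-V-V {α} {β} α⊥β zero = coprime-sym (1-coprimeTo 0)
coprime-V-V {α} {β} α⊥β (suc i) = subst (Coprime (V α β (suc i)))
  (trans (+-comm (β * V α β i) (V α β (suc i) * α)) (cong (_+ β * V α β i) (*-comm (V α β (suc i)) α)))
  (coprime-+-* α (coprime-* (coprime-sym (coprime-β-V α⊥β i)) (coprime-sym (coprime-V-V α⊥β i))))

coprime-U-V : ∀ {α β j} → Coprime α β → 1 ≤ j → Coprime (U α β j) (V α β j)
coprime-U-V {α} {β} {suc i} α⊥β _ = subst (λ u → Coprime u (V α β (suc i))) (sym (U-suc α β i))
  (coprime-sym (coprime-* (coprime-sym (coprime-β-V α⊥β i)) (coprime-sym (coprime-V-V α⊥β i))))

greatest : ∀ {P : ℕ → Set} → (∀ s → Dec (P s)) → ∀ K → (∀ s → P s → s ≤ K) →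
  ∀ {s₀} → P s₀ → Σ ℕ λ s → P s × (∀ t → P t → t ≤ s)
greatest {P} P? K bound {s₀} p₀ with P? K
... | yes p = K , p , bound
greatest {P} P? zero bound {s₀} p₀ | no ¬p = ⊥-elim (¬p (subst P (n≤0⇒n≡0 (bound s₀ p₀)) p₀))
greatest {P} P? (suc K) bound p₀ | no ¬p =
  greatest P? K (λ s ps → ≤-pred (≤∧≢⇒< (bound s ps) λ { refl → ¬p ps })) p₀

OccursBounded : ℕ → ℕ → ℕ → ℕ → Set
OccursBounded α β n s = Σ ℕ λ a₁ → a₁ < suc n × Σ ℕ λ a₂ → a₂ < suc n ×
  (1 ≤ a₁) × (1 ≤ a₂) × (1 ≤ s) × (walk α β a₁ a₂ s ≡ n)

occursBounded? : ∀ α β n s → Dec (OccursBounded α β n s)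
occursBounded? α β n s =
  anyUpTo? (λ a₁ → anyUpTo? (λ a₂ → 1 ≤? a₁ ×-dec 1 ≤? a₂ ×-dec 1 ≤? s ×-dec walk α β a₁ a₂ s ≟ n) (suc n)) (suc n)

-- At index 1 (resp. 2) the value a₂ (resp. a₁) is irrelevant and is replaced by 1.
occurs⇒occursBounded : ∀ {α β n s} → 1 ≤ α → 1 ≤ β → Occurs α β n s → OccursBounded α β n s
occurs⇒occursBounded {s = suc zero} 1≤α 1≤β (a₁ , a₂ , 1≤a₁ , 1≤a₂ , 1≤s , w≡n) =
  a₁ , s≤s (≤-reflexive w≡n) , 1 , s≤s (subst (1 ≤_) w≡n 1≤a₁) , 1≤a₁ , ≤-refl , 1≤s , w≡n
occurs⇒occursBounded {s = suc (suc zero)} 1≤α 1≤β (a₁ , a₂ , 1≤a₁ , 1≤a₂ , 1≤s , w≡n) =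
  1 , s≤s (subst (1 ≤_) w≡n 1≤a₂) , a₂ , s≤s (≤-reflexive w≡n) , ≤-refl , 1≤a₂ , 1≤s , w≡n
occurs⇒occursBounded {α} {β} {s = suc (suc (suc i))} 1≤α 1≤β (a₁ , a₂ , 1≤a₁ , 1≤a₂ , 1≤s , w≡n) =
  a₁ , s≤s (subst (a₁ ≤_) w≡n (walk₀-≥-a₁ 1≤α 1≤β i)) ,
  a₂ , s≤s (subst (a₂ ≤_) w≡n (walk₀-≥-a₂ 1≤α (suc i))) , 1≤a₁ , 1≤a₂ , 1≤s , w≡n

occurs⇒index≤ : ∀ {α β n s} → 1 ≤ α → 1 ≤ β → Occurs α β n s → s ≤ suc n
occurs⇒index≤ {s = zero} 1≤α 1≤β _ = z≤n
occurs⇒index≤ {s = suc s} 1≤α 1≤β (a₁ , a₂ , 1≤a₁ , 1≤a₂ , _ , w≡n) =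
  s≤s (subst (s ≤_) w≡n (index≤walk₀ 1≤α 1≤β 1≤a₁ 1≤a₂ s))

IsS-exists : ∀ {α β n s₀} → 1 ≤ α → 1 ≤ β → Occurs α β n s₀ → Σ ℕ λ s → IsS α β n s × s₀ ≤ s
IsS-exists {α} {β} {n} {s₀} 1≤α 1≤β occ =
  let s , occB , max = greatest (occursBounded? α β n) (suc n)
        (λ s occB → occurs⇒index≤ 1≤α 1≤β (forget occB)) (bound occ)
  in s , (forget occB , λ t → max t ∘ bound) , max s₀ (bound occ)
  where
  bound : ∀ {s} → Occurs α β n s → OccursBounded α β n s
  bound = occurs⇒occursBounded 1≤α 1≤β
  forget : ∀ {s} → OccursBounded α β n s → Occurs α β n s
  forget (a₁ , _ , a₂ , _ , h) = a₁ , a₂ , h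

range : ℕ → List ℕ
range zero = []
range (suc n) = suc n ∷ range n

length-range : ∀ n → length (range n) ≡ n
length-range zero = refl
length-range (suc n) = cong suc (length-range n)

∈-range⁻ : ∀ {n m} → m ∈ range n → (1 ≤ m) × (m ≤ n)
∈-range⁻ {suc n} (here refl) = s≤s z≤n , ≤-refl
∈-range⁻ {suc n} (there m∈) = let 1≤m , m≤n = ∈-range⁻ m∈ in 1≤m , m≤n⇒m≤1+n m≤n

∈-range⁺ : ∀ {n m} → 1 ≤ m → m ≤ n → m ∈ range n
∈-range⁺ {zero} (s≤s _) ()
∈-range⁺ {suc n} {m} 1≤m m≤1+n with m ≟ suc n
... | yes refl = here refl
... | no m≢1+n = there (∈-range⁺ 1≤m (≤-pred (≤∧≢⇒< m≤1+n m≢1+n)))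

range-unique : ∀ n → Unique (range n)
range-unique zero = []
range-unique (suc n) =
  tabulate (λ m∈ 1+n≡m → <-irrefl (sym 1+n≡m) (s≤s (proj₂ (∈-range⁻ m∈)))) ∷ range-unique n

remove : ∀ {x : ℕ} {ys} → x ∈ ys → List ℕ
remove {ys = y ∷ ys} (here _) = ys
remove {ys = y ∷ ys} (there x∈) = y ∷ remove x∈

length-remove : ∀ {x : ℕ} {ys} (x∈ : x ∈ ys) → suc (length (remove x∈)) ≡ length ys
length-remove {ys = y ∷ ys} (here _) = refl
length-remove {ys = y ∷ ys} (there x∈) = cong suc (length-remove x∈)

∈-remove : ∀ {x z : ℕ} {ys} (x∈ : x ∈ ys) → z ∈ ys → x ≢ z → z ∈ remove x∈
∈-remove (here refl) (here refl) x≢z = ⊥-elim (x≢z refl)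
∈-remove (here _) (there z∈) x≢z = z∈
∈-remove (there x∈) (here refl) x≢z = here refl
∈-remove (there x∈) (there z∈) x≢z = there (∈-remove x∈ z∈ x≢z)

unique-⊆⇒length≤ : ∀ {xs ys : List ℕ} → Unique xs → (∀ {z} → z ∈ xs → z ∈ ys) → length xs ≤ length ys
unique-⊆⇒length≤ {[]} _ _ = z≤n
unique-⊆⇒length≤ {x ∷ xs} {ys} (x∉xs ∷ xs!) xs⊆ys =
  subst (suc (length xs) ≤_) (length-remove x∈ys)
    (s≤s (unique-⊆⇒length≤ xs! λ z∈ → ∈-remove x∈ys (xs⊆ys (there z∈)) (distinct x∉xs z∈)))
  where
  x∈ys = xs⊆ys (here refl)
  distinct : ∀ {x : ℕ} {zs z} → All (x ≢_) zs → z ∈ zs → x ≢ z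
  distinct (x≢z ∷ _) (here refl) = x≢z
  distinct (_ ∷ x≢zs) (there z∈) = distinct x≢zs z∈

count : {P : Pred ℕ 0ℓ} → Decidable P → List ℕ → ℕ
count P? xs = length (filter P? xs)

count-≤-range : ∀ {P : Pred ℕ 0ℓ} (P? : Decidable P) n K → (∀ m → P m → m ≤ K) → count P? (range n) ≤ K
count-≤-range P? n K P⇒≤K = subst (count P? (range n) ≤_) (length-range K)
  (unique-⊆⇒length≤ (filter⁺ P? (range-unique n)) λ m∈ →
    let m∈range , Pm = ∈-filter⁻ P? {xs = range n} m∈ in
    ∈-range⁺ (proj₁ (∈-range⁻ m∈range)) (P⇒≤K _ Pm))

length≤count+count : ∀ {P Q : Pred ℕ 0ℓ} (P? : Decidable P) (Q? : Decidable Q) →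
  (∀ m → ¬ P m → Q m) → ∀ xs → length xs ≤ count P? xs + count Q? xs
length≤count+count P? Q? cover [] = z≤n
length≤count+count P? Q? cover (x ∷ xs) with ih ← length≤count+count P? Q? cover xs | P? x | Q? x
... | yes _ | yes _ = s≤s (≤-trans ih (+-monoʳ-≤ _ (n≤1+n _)))
... | yes _ | no _ = s≤s ih
... | no ¬Px | yes _ = subst (suc (length xs) ≤_) (sym (+-suc _ _)) (s≤s ih)
... | no ¬Px | no ¬Qx = ⊥-elim (¬Qx (cover x ¬Px))

count-∪ : ∀ {P Q : Pred ℕ 0ℓ} (P? : Decidable P) (Q? : Decidable Q) xs →
  count (P? ∪? Q?) xs ≤ count P? xs + count Q? xs
count-∪ P? Q? [] = z≤n
count-∪ P? Q? (x ∷ xs) with ih ← count-∪ P? Q? xs | P? x | Q? x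
... | yes _ | yes _ = s≤s (≤-trans ih (+-monoʳ-≤ _ (n≤1+n _)))
... | yes _ | no _ = s≤s ih
... | no _ | yes _ = subst (suc (count (P? ∪? Q?) xs) ≤_) (sym (+-suc _ _)) (s≤s ih)
... | no _ | no _ = ih

count-mono : ∀ {P Q : Pred ℕ 0ℓ} (P? : Decidable P) (Q? : Decidable Q) →
  (∀ m → P m → Q m) → ∀ xs → count P? xs ≤ count Q? xs
count-mono P? Q? P⇒Q [] = z≤n
count-mono P? Q? P⇒Q (x ∷ xs) with ih ← count-mono P? Q? P⇒Q xs | P? x | Q? x
... | yes _ | yes _ = s≤s ih
... | yes Px | no ¬Qx = ⊥-elim (¬Qx (P⇒Q x Px))
... | no _ | yes _ = m≤n⇒m≤1+n ih
... | no _ | no _ = ih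

count-none : ∀ {P : Pred ℕ 0ℓ} (P? : Decidable P) → (∀ m → ¬ P m) → ∀ xs → count P? xs ≡ 0
count-none P? ¬P [] = refl
count-none P? ¬P (x ∷ xs) with P? x
... | yes Px = ⊥-elim (¬P x Px)
... | no _ = count-none P? ¬P xs

module _ {Q : Set} {B : Q → Pred ℕ 0ℓ} (B? : ∀ q → Decidable (B q)) where

  AnyB : List Q → Pred ℕ 0ℓ
  AnyB F m = Any (λ q → B q m) F

  anyB? : ∀ F → Decidable (AnyB F)
  anyB? F m = any? (λ q → B? q m) F

  count-anyB : ∀ F K n xs → (∀ q → count (B? q) xs * K ≤ n) → count (anyB? F) xs * K ≤ length F * n
  count-anyB [] K n xs _ = ≤-reflexive (cong (_* K) (count-none (anyB? []) (λ _ ()) xs))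
  count-anyB (q ∷ F) K n xs bound = begin
    count (anyB? (q ∷ F)) xs * K                     ≤⟨ *-monoˡ-≤ K (count-mono (anyB? (q ∷ F)) (B? q ∪? anyB? F) split xs) ⟩
    count (B? q ∪? anyB? F) xs * K                   ≤⟨ *-monoˡ-≤ K (count-∪ (B? q) (anyB? F) xs) ⟩
    (count (B? q) xs + count (anyB? F) xs) * K       ≡⟨ *-distribʳ-+ K (count (B? q) xs) _ ⟩
    count (B? q) xs * K + count (anyB? F) xs * K     ≤⟨ +-mono-≤ (bound q) (count-anyB F K n xs bound) ⟩
    n + length F * n                                 ∎
    where
    open ≤-Reasoning
    split : ∀ m → AnyB (q ∷ F) m → (B q ∪ AnyB F) m
    split m (here b) = inj₁ b
    split m (there b) = inj₂ b

grid : ℕ → ℕ → ℕ → ℕ → List ℕ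
grid u v zero b = []
grid u v (suc a) b = map (λ y → suc a * u + y * v) (range b) ++ grid u v a b

length-grid : ∀ u v a b → length (grid u v a b) ≡ a * b
length-grid u v zero b = refl
length-grid u v (suc a) b = trans (length-++ (map (λ y → suc a * u + y * v) (range b)))
  (cong₂ _+_ (trans (length-map _ (range b)) (length-range b)) (length-grid u v a b))

∈-grid : ∀ {u v a b x y} → 1 ≤ x → x ≤ a → 1 ≤ y → y ≤ b → x * u + y * v ∈ grid u v a b
∈-grid {a = zero} (s≤s _) ()
∈-grid {u} {v} {suc a} {b} {x} 1≤x x≤1+a 1≤y y≤b with x ≟ suc a
... | yes refl = ∈-++⁺ˡ (∈-map⁺ (λ y → suc a * u + y * v) (∈-range⁺ 1≤y y≤b))
... | no x≢1+a = ∈-++⁺ʳ (map (λ y → suc a * u + y * v) (range b))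
                   (∈-grid 1≤x (≤-pred (≤∧≢⇒< x≤1+a x≢1+a)) 1≤y y≤b)

count-representable : ∀ {P : Pred ℕ 0ℓ} (P? : Decidable P) u v n .{{_ : NonZero u}} .{{_ : NonZero v}} →
  (∀ m → P m → Representable u v m) → count P? (range n) * (u * v) ≤ n * n
count-representable P? u v n P⇒rep = begin
  count P? (range n) * (u * v)          ≤⟨ *-monoˡ-≤ (u * v) (subst (count P? (range n) ≤_)
                                             (length-grid u v (n / u) (n / v))
                                             (unique-⊆⇒length≤ (filter⁺ P? (range-unique n)) ⊆grid)) ⟩
  (n / u) * (n / v) * (u * v)           ≡⟨ interchange (n / u) (n / v) u v ⟩
  ((n / u) * u) * ((n / v) * v)         ≤⟨ *-mono-≤ (m/n*n≤m n u) (m/n*n≤m n v) ⟩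
  n * n                                 ∎
  where
  open ≤-Reasoning
  interchange : ∀ a b u v → a * b * (u * v) ≡ (a * u) * (b * v)
  interchange = solve-∀
  ≤-quotient : ∀ x w .{{_ : NonZero w}} → x * w ≤ n → x ≤ n / w
  ≤-quotient x w xw≤n = subst (_≤ n / w) (m*n/n≡m x w) (/-monoˡ-≤ w xw≤n)
  ⊆grid : ∀ {m} → m ∈ filter P? (range n) → m ∈ grid u v (n / u) (n / v)
  ⊆grid m∈ with ∈-filter⁻ P? {xs = range n} m∈
  ... | m∈range , Pm with P⇒rep _ Pm | ∈-range⁻ m∈range
  ...   | x , y , 1≤x , 1≤y , refl | _ , m≤n =
    ∈-grid 1≤x (≤-quotient x u (≤-trans (m≤m+n (x * u) (y * v)) m≤n))
           1≤y (≤-quotient y v (≤-trans (m≤n+m (y * v) (x * u)) m≤n))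

RepresentableUpTo : ℕ → ℕ → ℕ → Set
RepresentableUpTo u v m = Σ ℕ λ x → x < suc m × Σ ℕ λ y → y < suc m × (1 ≤ x) × (1 ≤ y) × (x * u + y * v ≡ m)

representableUpTo? : ∀ u v → Decidable (RepresentableUpTo u v)
representableUpTo? u v m =
  anyUpTo? (λ x → anyUpTo? (λ y → 1 ≤? x ×-dec 1 ≤? y ×-dec x * u + y * v ≟ m) (suc m)) (suc m)

representable⇒representableUpTo : ∀ {u v m} → 1 ≤ u → 1 ≤ v → Representable u v m → RepresentableUpTo u v m
representable⇒representableUpTo {u} {v} 1≤u 1≤v (x , y , 1≤x , 1≤y , refl) =
  x , s≤s (≤-trans (m≤m*n x u {{>-nonZero 1≤u}}) (m≤m+n _ _)) ,
  y , s≤s (≤-trans (m≤m*n y v {{>-nonZero 1≤v}}) (m≤n+m _ _)) , 1≤x , 1≤y , refl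

representableUpTo⇒representable : ∀ {u v m} → RepresentableUpTo u v m → Representable u v m
representableUpTo⇒representable (x , _ , y , _ , h) = x , y , h

representable⇒v≤ : ∀ {u v m} → Representable u v m → v ≤ m
representable⇒v≤ {u} {v} (x , y , _ , 1≤y , refl) = ≤-trans (m≤n*m v y {{>-nonZero 1≤y}}) (m≤n+m _ _)

bracket : (f : ℕ → ℕ) (n : ℕ) → ∀ t j → f j ≤ n → n < f (j + t) →
  Σ ℕ λ j₁ → (j ≤ j₁) × (f j₁ ≤ n) × (n < f (suc j₁))
bracket f n zero j fj≤n n<fj+0 = ⊥-elim (<-irrefl refl (<-≤-trans n<fj+0 (subst (λ i → f i ≤ n) (sym (+-identityʳ j)) fj≤n)))
bracket f n (suc t) j fj≤n n<fj+1+t with suc n ≤? f (suc j)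
... | yes n<f1+j = j , ≤-refl , fj≤n , n<f1+j
... | no n≮f1+j =
  let j₁ , 1+j≤j₁ , fj₁≤n , n<f1+j₁ = bracket f n t (suc j) (≮⇒≥ n≮f1+j) (subst (λ i → n < f i) (+-suc j t) n<fj+1+t)
  in j₁ , ≤-trans (n≤1+n j) 1+j≤j₁ , fj₁≤n , n<f1+j₁

box : ℕ → ℕ → List Pair
box A M = cartesianProduct (range A) (range M)

∈-box : ∀ {α β A M} → 1 ≤ α → α ≤ A → 1 ≤ β → β ≤ M → (α , β) ∈ box A M
∈-box 1≤α α≤A 1≤β β≤M = ∈-cartesianProduct⁺ (∈-range⁺ 1≤α α≤A) (∈-range⁺ 1≤β β≤M)

∈⇒1≤length : ∀ {A : Set} {x : A} {xs} → x ∈ xs → 1 ≤ length xs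
∈⇒1≤length (here _) = s≤s z≤n
∈⇒1≤length (there _) = s≤s z≤n

1≤m*n⇒1≤m : ∀ m n → 1 ≤ m * n → 1 ≤ m
1≤m*n⇒1≤m (suc m) n _ = s≤s z≤n

^-distribʳ-* : ∀ x y e → (x * y) ^ e ≡ x ^ e * y ^ e
^-distribʳ-* x y zero = refl
^-distribʳ-* x y (suc e) rewrite ^-distribʳ-* x y e = interchange x y (x ^ e) (y ^ e)
  where
  interchange : ∀ x y s t → x * y * (s * t) ≡ x * s * (y * t)
  interchange = solve-∀

^-pos : ∀ {x} e → 1 ≤ x → 1 ≤ x ^ e
^-pos {x} e 1≤x = m^n>0 x {{>-nonZero 1≤x}} e

V-upper : ∀ α β a b → α * a * b + β * b * b ≤ a * a → 1 ≤ a → ∀ i → b ^ i * V α β i ≤ b * a ^ i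
V-upper α β a b above 1≤a zero = z≤n
V-upper α β a b above 1≤a (suc zero) =
  ≤-trans (≤-reflexive (*-assoc b 1 1)) (*-monoʳ-≤ b (*-monoˡ-≤ 1 1≤a))
V-upper α β a b above 1≤a (suc (suc i)) = begin
  b ^ suc (suc i) * (α * V α β (suc i) + β * V α β i)
    ≡⟨ split α β b (b ^ i) (V α β (suc i)) (V α β i) ⟩
  α * b * (b ^ suc i * V α β (suc i)) + β * b * b * (b ^ i * V α β i)
    ≤⟨ +-mono-≤ (*-monoʳ-≤ (α * b) (V-upper α β a b above 1≤a (suc i))) (*-monoʳ-≤ (β * b * b) (V-upper α β a b above 1≤a i)) ⟩
  α * b * (b * a ^ suc i) + β * b * b * (b * a ^ i)
    ≡⟨ factor α β a b (a ^ i) ⟩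
  b * a ^ i * (α * a * b + β * b * b)
    ≤⟨ *-monoʳ-≤ (b * a ^ i) above ⟩
  b * a ^ i * (a * a)
    ≡⟨ regroup a b (a ^ i) ⟩
  b * a ^ suc (suc i) ∎
  where
  open ≤-Reasoning
  split : ∀ α β b t v₁ v₀ → b * (b * t) * (α * v₁ + β * v₀) ≡ α * b * ((b * t) * v₁) + β * b * b * (t * v₀)
  split = solve-∀
  factor : ∀ α β a b s → α * b * (b * (a * s)) + β * b * b * (b * s) ≡ b * s * (α * a * b + β * b * b)
  factor = solve-∀
  regroup : ∀ a b s → b * s * (a * a) ≡ b * (a * (a * s))
  regroup = solve-∀

V-lower : ∀ α β a b → a * a ≤ α * a * b + β * b * b → 1 ≤ a → 1 ≤ b → 1 ≤ α →
  ∀ i → a ^ suc i ≤ a * a * (b ^ suc i * V α β (suc i))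
V-lower α β a b below 1≤a 1≤b 1≤α zero =
  ≤-trans (*-monoʳ-≤ a 1≤a) (m≤m*n (a * a) _ {{>-nonZero (*-mono-≤ (*-mono-≤ 1≤b ≤-refl) ≤-refl)}})
V-lower α β a b below 1≤a 1≤b 1≤α (suc zero) =
  ≤-trans (≤-reflexive (sym (*-assoc a a 1)))
    (*-monoʳ-≤ (a * a) (*-mono-≤ (*-mono-≤ 1≤b (*-mono-≤ 1≤b ≤-refl)) (+-mono-≤ (*-mono-≤ 1≤α ≤-refl) z≤n)))
V-lower α β a b below 1≤a 1≤b 1≤α (suc (suc i)) = begin
  a ^ suc (suc (suc i))
    ≡⟨ regroup a (a ^ suc i) ⟩
  a ^ suc i * (a * a)
    ≤⟨ *-monoʳ-≤ (a ^ suc i) below ⟩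
  a ^ suc i * (α * a * b + β * b * b)
    ≡⟨ split α β a b (a ^ suc i) ⟩
  α * b * a ^ suc (suc i) + β * b * b * a ^ suc i
    ≤⟨ +-mono-≤ (*-monoʳ-≤ (α * b) (V-lower α β a b below 1≤a 1≤b 1≤α (suc i)))
                (*-monoʳ-≤ (β * b * b) (V-lower α β a b below 1≤a 1≤b 1≤α i)) ⟩
  α * b * (a * a * (b ^ suc (suc i) * V α β (suc (suc i)))) + β * b * b * (a * a * (b ^ suc i * V α β (suc i)))
    ≡⟨ factor α β (a * a) b (b ^ suc i) (V α β (suc (suc i))) (V α β (suc i)) ⟩
  a * a * (b ^ suc (suc (suc i)) * (α * V α β (suc (suc i)) + β * V α β (suc i))) ∎
  where
  open ≤-Reasoning
  regroup : ∀ a s → a * (a * s) ≡ s * (a * a)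
  regroup = solve-∀
  split : ∀ α β a b s → s * (α * a * b + β * b * b) ≡ α * b * (a * s) + β * b * b * s
  split = solve-∀
  factor : ∀ α β K b t v₁ v₀ →
    α * b * (K * ((b * t) * v₁)) + β * b * b * (K * (t * v₀)) ≡ K * (b * (b * t) * (α * v₁ + β * v₀))
  factor = solve-∀

bernoulli : ∀ {u v} → v + 1 ≤ u → ∀ e → v ^ e * (v + e) ≤ u ^ e * v
bernoulli {u} {v} v<u zero = ≤-reflexive (cong (1 *_) (+-identityʳ v))
bernoulli {u} {v} v<u (suc e) = begin
  v * v ^ e * (v + suc e)                ≤⟨ m≤m+n _ (v ^ e * e) ⟩
  v * v ^ e * (v + suc e) + v ^ e * e    ≡⟨ regroup v (v ^ e) e ⟩
  (v + 1) * (v ^ e * (v + e))            ≤⟨ *-mono-≤ v<u (bernoulli v<u e) ⟩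
  u * (u ^ e * v)                        ≡⟨ *-assoc u (u ^ e) v ⟨
  u * u ^ e * v                          ∎
  where
  open ≤-Reasoning
  regroup : ∀ v t e → v * t * (v + (1 + e)) + t * e ≡ (v + 1) * (t * (v + e))
  regroup = solve-∀

-- (u / v) ^ e ≥ 1 + e / v ≥ C once e ≥ v C.
bernoulli-≥ : ∀ {u v} C e → v + 1 ≤ u → 1 ≤ v → v * C ≤ e → C * v ^ e ≤ u ^ e
bernoulli-≥ {u} {v} C e v<u 1≤v vC≤e = *-cancelʳ-≤ (C * v ^ e) (u ^ e) v {{>-nonZero 1≤v}} (begin
  C * v ^ e * v          ≡⟨ regroup C (v ^ e) v ⟩
  v ^ e * (v * C)        ≤⟨ *-monoʳ-≤ (v ^ e) (≤-trans vC≤e (m≤n+m e v)) ⟩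
  v ^ e * (v + e)        ≤⟨ bernoulli v<u e ⟩
  u ^ e * v              ∎)
  where
  open ≤-Reasoning
  regroup : ∀ c t v → c * t * v ≡ t * (v * c)
  regroup = solve-∀

-- V α β i / V α' β' (i + 1) grows at least like (a₂ b / (a b₂)) ^ i, which beats any
-- constant by bernoulli-≥.
V-dominates : ∀ α' β' α β a b a₂ b₂ K →
  α' * a * b + β' * b * b ≤ a * a → 1 ≤ a → 1 ≤ b →
  a₂ * a₂ ≤ α * a₂ * b₂ + β * b₂ * b₂ → 1 ≤ a₂ → 1 ≤ b₂ → 1 ≤ α →
  a * b₂ + 1 ≤ a₂ * b →
  ∀ t → (a * b₂) * (K * a * (a₂ * a₂)) ≤ suc t → K * V α' β' (suc (suc t)) ≤ V α β (suc t)
V-dominates α' β' α β a b a₂ b₂ K above 1≤a 1≤b below 1≤a₂ 1≤b₂ 1≤α gap t large =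
  *-cancelʳ-≤ (K * V α' β' (suc i)) (V α β i) Z {{>-nonZero 1≤Z}} (begin
    K * V α' β' (suc i) * Z
      ≡⟨ regroup₁ K (V α' β' (suc i)) (b ^ suc i) (a₂ * a₂) (b₂ ^ i) ⟩
    K * (a₂ * a₂) * b₂ ^ i * (b ^ suc i * V α' β' (suc i))
      ≤⟨ *-monoʳ-≤ (K * (a₂ * a₂) * b₂ ^ i) (V-upper α' β' a b above 1≤a (suc i)) ⟩
    K * (a₂ * a₂) * b₂ ^ i * (b * (a * a ^ i))
      ≡⟨ regroup₂ K a₂ (b₂ ^ i) b a (a ^ i) ⟩
    b * (C * (a ^ i * b₂ ^ i))
      ≡⟨ cong (λ z → b * (C * z)) (^-distribʳ-* a b₂ i) ⟨
    b * (C * (a * b₂) ^ i)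
      ≤⟨ *-monoʳ-≤ b (bernoulli-≥ C i gap (*-mono-≤ 1≤a 1≤b₂) large) ⟩
    b * (a₂ * b) ^ i
      ≡⟨ cong (b *_) (^-distribʳ-* a₂ b i) ⟩
    b * (a₂ ^ i * b ^ i)
      ≤⟨ *-monoʳ-≤ b (*-monoˡ-≤ (b ^ i) (V-lower α β a₂ b₂ below 1≤a₂ 1≤b₂ 1≤α t)) ⟩
    b * (a₂ * a₂ * (b₂ ^ i * V α β i) * b ^ i)
      ≡⟨ regroup₃ b (a₂ * a₂) (b₂ ^ i) (V α β i) (b ^ i) ⟩
    V α β i * Z ∎)
  where
  open ≤-Reasoning
  i = suc t
  C = K * a * (a₂ * a₂)
  Z = b ^ suc i * (a₂ * a₂) * b₂ ^ i
  1≤Z : 1 ≤ Z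
  1≤Z = *-mono-≤ (*-mono-≤ (^-pos (suc i) 1≤b) (*-mono-≤ 1≤a₂ 1≤a₂)) (^-pos i 1≤b₂)
  regroup₁ : ∀ K w P Q R → K * w * (P * Q * R) ≡ K * Q * R * (P * w)
  regroup₁ = solve-∀
  regroup₂ : ∀ K a₂ r b a s → K * (a₂ * a₂) * r * (b * (a * s)) ≡ b * (K * a * (a₂ * a₂) * (s * r))
  regroup₂ = solve-∀
  regroup₃ : ∀ b q r w s → b * (q * (r * w) * s) ≡ w * (b * s * q * r)
  regroup₃ = solve-∀

-- (a L + 1) / (b L) = a / b + 1 / (b L) with L = 2 a + 1 is still ≤ γ_{α,β}.
fraction-below : ∀ α β a b → a * a < α * a * b + β * b * b →
  (a * (2 * a + 1) + 1) * (a * (2 * a + 1) + 1) ≤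
  α * (a * (2 * a + 1) + 1) * (b * (2 * a + 1)) + β * (b * (2 * a + 1)) * (b * (2 * a + 1))
fraction-below α β a b below = begin
  (a * L + 1) * (a * L + 1)                       ≡⟨ expand a L ⟩
  a * a * (L * L) + (2 * a * L + 1)               ≤⟨ +-monoʳ-≤ (a * a * (L * L)) (+-monoʳ-≤ (2 * a * L) (m≤m+n 1 (2 * a))) ⟩
  a * a * (L * L) + (2 * a * L + (1 + 2 * a))     ≡⟨ cong (a * a * (L * L) +_) (square a) ⟩
  a * a * (L * L) + L * L                         ≡⟨ +-comm (a * a * (L * L)) (L * L) ⟩
  L * L + a * a * (L * L)                         ≡⟨ *-comm (suc (a * a)) (L * L) ⟩
  L * L * suc (a * a)                             ≤⟨ *-monoʳ-≤ (L * L) below ⟩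
  L * L * (α * a * b + β * b * b)                 ≤⟨ m≤m+n _ (α * b * L) ⟩
  L * L * (α * a * b + β * b * b) + α * b * L     ≡⟨ regroup α β a b L ⟩
  α * (a * L + 1) * (b * L) + β * (b * L) * (b * L) ∎
  where
  open ≤-Reasoning
  L = 2 * a + 1
  expand : ∀ a L → (a * L + 1) * (a * L + 1) ≡ a * a * (L * L) + (2 * a * L + 1)
  expand = solve-∀
  square : ∀ a → 2 * a * (2 * a + 1) + (1 + 2 * a) ≡ (2 * a + 1) * (2 * a + 1)
  square = solve-∀
  regroup : ∀ α β a b L → L * L * (α * a * b + β * b * b) + α * b * L ≡ α * (a * L + 1) * (b * L) + β * (b * L) * (b * L)
  regroup = solve-∀

fraction-gap : ∀ a b → 1 ≤ b → a * (b * (2 * a + 1)) + 1 ≤ (a * (2 * a + 1) + 1) * b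
fraction-gap a b 1≤b = begin
  a * (b * (2 * a + 1)) + 1     ≤⟨ +-monoʳ-≤ _ 1≤b ⟩
  a * (b * (2 * a + 1)) + b     ≡⟨ regroup a b ⟩
  (a * (2 * a + 1) + 1) * b     ∎
  where
  open ≤-Reasoning
  regroup : ∀ a b → a * (b * (2 * a + 1)) + b ≡ (a * (2 * a + 1) + 1) * b
  regroup = solve-∀

<-^ : ∀ {s} t → 2 ≤ s → t < s ^ t
<-^ zero 2≤s = s≤s z≤n
<-^ {s} (suc t) 2≤s = begin-strict
  suc t               <⟨ s≤s (<-^ t 2≤s) ⟩
  1 + s ^ t           ≤⟨ +-mono-≤ (^-pos t (≤-trans (s≤s z≤n) 2≤s)) (m≤m+n (s ^ t) 0) ⟩
  2 * s ^ t           ≤⟨ *-monoˡ-≤ (s ^ t) 2≤s ⟩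
  s * s ^ t           ∎
  where open ≤-Reasoning

unit-denominator : ∀ α β s → α * s * 1 + β * 1 * 1 ≡ α * s + β
unit-denominator = solve-∀

V≤^ : ∀ α β s → α * s + β ≤ s * s → 1 ≤ s → ∀ j → V α β j ≤ s ^ j
V≤^ α β s above 1≤s j = subst₂ _≤_
  (trans (cong (_* V α β j) (^-zeroˡ j)) (*-identityˡ _)) (*-identityˡ _)
  (V-upper α β s 1 (subst (_≤ s * s) (sym (unit-denominator α β s)) above) 1≤s j)

^≤V : ∀ α β s → s * s ≤ α * s + β → 1 ≤ s → 1 ≤ α → ∀ i → s ^ suc i ≤ s * s * V α β (suc i)
^≤V α β s below 1≤s 1≤α i = subst (s ^ suc i ≤_)
  (cong (s * s *_) (trans (cong (_* V α β (suc i)) (^-zeroˡ (suc i))) (*-identityˡ _)))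
  (V-lower α β s 1 (subst (s * s ≤_) (sym (unit-denominator α β s)) below) 1≤s ≤-refl 1≤α i)

-- V α β grows at least like the cube of V α' β'.
V-dominates-large : ∀ α' β' α β s C t →
  α' * s + β' ≤ s * s → 2 ≤ s → (s * s * s) * (s * s * s) ≤ α * (s * s * s) + β → 1 ≤ α → C ≤ t →
  C * (V α' β' (7 + t) * V α' β' (8 + t)) ≤ V α β (7 + t)
V-dominates-large α' β' α β s C t above 2≤s below 1≤α C≤t =
  *-cancelʳ-≤ _ _ (A * A) {{>-nonZero (*-mono-≤ 1≤A 1≤A)}} (begin
    C * (V α' β' j * V α' β' (suc j)) * (A * A)
      ≤⟨ *-monoˡ-≤ (A * A) (*-monoʳ-≤ C (*-mono-≤ (V≤^ α' β' s above 1≤s j) (V≤^ α' β' s above 1≤s (suc j)))) ⟩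
    C * (s ^ j * (s * s ^ j)) * (A * A)
      ≡⟨ regroup C (s ^ j) s ⟩
    s ^ j * s ^ j * (C * (s * (s * s * s) * (s * s * s)))
      ≤⟨ *-monoʳ-≤ (s ^ j * s ^ j) (≤-trans (*-monoˡ-≤ _ (<⇒≤ (≤-<-trans C≤t (<-^ t 2≤s)))) (≤-reflexive (s⁷ (s ^ t) s))) ⟩
    s ^ j * s ^ j * s ^ j
      ≡⟨ trans (^-distribʳ-* (s * s) s j) (cong (_* s ^ j) (^-distribʳ-* s s j)) ⟨
    A ^ j
      ≤⟨ ^≤V α β A below 1≤A 1≤α (6 + t) ⟩
    A * A * V α β j
      ≡⟨ *-comm (A * A) _ ⟩
    V α β j * (A * A) ∎)
  where
  open ≤-Reasoning
  j = 7 + t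
  A = s * s * s
  1≤s = ≤-trans (s≤s z≤n) 2≤s
  1≤A = *-mono-≤ (*-mono-≤ 1≤s 1≤s) 1≤s
  regroup : ∀ C q s → C * (q * (s * q)) * (s * s * s * (s * s * s)) ≡ q * q * (C * (s * (s * s * s) * (s * s * s)))
  regroup = solve-∀
  s⁷ : ∀ r s → r * (s * (s * s * s) * (s * s * s)) ≡ s * (s * (s * (s * (s * (s * (s * r))))))
  s⁷ = solve-∀

≤⇒excess : ∀ {u v} → u ≤ v → Σ ℕ λ f → v ≡ u + f
≤⇒excess {u} {v} u≤v = v ∸ u , sym (m+[n∸m]≡n u≤v)

≡+∸ : ∀ {u v} → u < v → v ≡ u + (v ∸ u)
≡+∸ u<v = sym (m+[n∸m]≡n (<⇒≤ u<v))

<⇒excess : ∀ {u v} → u < v → Σ ℕ λ f → (v ≡ u + f) × (1 ≤ f)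
<⇒excess {u} {v} u<v = v ∸ u , ≡+∸ u<v , m<n⇒0<n∸m u<v

above⇒αy≤x : ∀ α β x y → 1 ≤ β → 1 ≤ y → α * x * y + β * y * y ≤ x * x → α * y ≤ x
above⇒αy≤x α β x y 1≤β 1≤y above with α * y ≤? x
... | yes αy≤x = αy≤x
... | no αy≰x = ⊥-elim (<-irrefl refl (≤-<-trans (≤-trans xx≤αxy (m≤m+n _ _)) (<-≤-trans αxy<αxy+βyy above)))
  where
  xx≤αxy : x * x ≤ α * x * y
  xx≤αxy = subst (x * x ≤_) (regroup α x y) (*-monoʳ-≤ x (<⇒≤ (≰⇒> αy≰x)))
    where
    regroup : ∀ α x y → x * (α * y) ≡ α * x * y
    regroup = solve-∀
  αxy<αxy+βyy : α * x * y + 0 < α * x * y + β * y * y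
  αxy<αxy+βyy = +-monoʳ-< (α * x * y) (*-mono-≤ (*-mono-≤ 1≤β 1≤y) 1≤y)

-- With D = x₁ y - x y₁ and f = x² - α x y - β y²:  (x₁ y)² = (x y₁ + D)², expanded and
-- rearranged so that no subtraction occurs.
above-mono-identity : ∀ α β x y x₁ y₁ f D → x * x ≡ α * x * y + β * y * y + f → x₁ * y ≡ x * y₁ + D →
  x₁ * x₁ * (y * y) + α * D * y * y₁ ≡
  (α * x₁ * y₁ + β * y₁ * y₁) * (y * y) + f * (y₁ * y₁) + 2 * D * x * y₁ + D * D
above-mono-identity α β x y x₁ y₁ f D xx≡ x₁y≡ = begin
  x₁ * x₁ * (y * y) + α * D * y * y₁
    ≡⟨ square-product x₁ y (α * D * y * y₁) ⟩
  (x₁ * y) * (x₁ * y) + α * D * y * y₁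
    ≡⟨ cong (λ t → t * t + α * D * y * y₁) x₁y≡ ⟩
  (x * y₁ + D) * (x * y₁ + D) + α * D * y * y₁
    ≡⟨ expand x y₁ D (α * D * y * y₁) ⟩
  (x * x) * (y₁ * y₁) + 2 * D * x * y₁ + D * D + α * D * y * y₁
    ≡⟨ cong (λ t → t * (y₁ * y₁) + 2 * D * x * y₁ + D * D + α * D * y * y₁) xx≡ ⟩
  (α * x * y + β * y * y + f) * (y₁ * y₁) + 2 * D * x * y₁ + D * D + α * D * y * y₁
    ≡⟨ regroup α β x y y₁ f D ⟩
  α * y * y₁ * (x * y₁ + D) + β * y₁ * y₁ * (y * y) + f * (y₁ * y₁) + 2 * D * x * y₁ + D * D
    ≡⟨ cong (λ t → α * y * y₁ * t + β * y₁ * y₁ * (y * y) + f * (y₁ * y₁) + 2 * D * x * y₁ + D * D) x₁y≡ ⟨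
  α * y * y₁ * (x₁ * y) + β * y₁ * y₁ * (y * y) + f * (y₁ * y₁) + 2 * D * x * y₁ + D * D
    ≡⟨ regroup′ α β x y x₁ y₁ f D ⟩
  (α * x₁ * y₁ + β * y₁ * y₁) * (y * y) + f * (y₁ * y₁) + 2 * D * x * y₁ + D * D ∎
  where
  open ≡-Reasoning
  square-product : ∀ x₁ y k → x₁ * x₁ * (y * y) + k ≡ (x₁ * y) * (x₁ * y) + k
  square-product = solve-∀
  expand : ∀ x y₁ D k → (x * y₁ + D) * (x * y₁ + D) + k ≡ (x * x) * (y₁ * y₁) + 2 * D * x * y₁ + D * D + k
  expand = solve-∀
  regroup : ∀ α β x y y₁ f D → (α * x * y + β * y * y + f) * (y₁ * y₁) + 2 * D * x * y₁ + D * D + α * D * y * y₁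
    ≡ α * y * y₁ * (x * y₁ + D) + β * y₁ * y₁ * (y * y) + f * (y₁ * y₁) + 2 * D * x * y₁ + D * D
  regroup = solve-∀
  regroup′ : ∀ α β x y x₁ y₁ f D →
    α * y * y₁ * (x₁ * y) + β * y₁ * y₁ * (y * y) + f * (y₁ * y₁) + 2 * D * x * y₁ + D * D
    ≡ (α * x₁ * y₁ + β * y₁ * y₁) * (y * y) + f * (y₁ * y₁) + 2 * D * x * y₁ + D * D
  regroup′ = solve-∀

excess-pos : ∀ {u v f} → v ≡ u + f → u < v → 1 ≤ f
excess-pos {u} {f = zero} v≡u+0 u<v = ⊥-elim (<-irrefl (sym (trans v≡u+0 (+-identityʳ u))) u<v)
excess-pos {f = suc _} _ _ = s≤s z≤n

above-mono : ∀ α β x y x₁ y₁ → 1 ≤ β → 1 ≤ y → α * x * y + β * y * y ≤ x * x → x * y₁ ≤ x₁ * y →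
  (x * y₁ < x₁ * y ⊎ (α * x * y + β * y * y < x * x × 1 ≤ y₁)) → α * x₁ * y₁ + β * y₁ * y₁ < x₁ * x₁
above-mono α β x y x₁ y₁ 1≤β 1≤y above xy₁≤x₁y one-strict =
  *-cancelʳ-< (y * y) _ _ (+-cancelʳ-≤ (α * D * y * y₁) _ _ (begin
    suc Q + α * D * y * y₁               ≤⟨ +-monoˡ-≤ _ (subst (_≤ Q + S) (+-comm Q 1) (+-monoʳ-≤ Q slack)) ⟩
    Q + S + α * D * y * y₁               ≤⟨ +-monoʳ-≤ (Q + S) αDyy₁≤2Dxy₁ ⟩
    Q + S + 2 * D * x * y₁               ≡⟨ regroup Q (f * (y₁ * y₁)) (D * D) (2 * D * x * y₁) ⟩
    Q + f * (y₁ * y₁) + 2 * D * x * y₁ + D * D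
                                         ≡⟨ above-mono-identity α β x y x₁ y₁ f D xx≡ x₁y≡ ⟨
    x₁ * x₁ * (y * y) + α * D * y * y₁   ∎))
  where
  open ≤-Reasoning
  f = proj₁ (≤⇒excess above)
  xx≡ = proj₂ (≤⇒excess above)
  D = proj₁ (≤⇒excess xy₁≤x₁y)
  x₁y≡ = proj₂ (≤⇒excess xy₁≤x₁y)
  Q = (α * x₁ * y₁ + β * y₁ * y₁) * (y * y)
  S = f * (y₁ * y₁) + D * D
  slack : 1 ≤ S
  slack = slack-from one-strict
    where
    slack-from : x * y₁ < x₁ * y ⊎ (α * x * y + β * y * y < x * x × 1 ≤ y₁) → 1 ≤ S
    slack-from (inj₁ xy₁<x₁y) = let 1≤D = excess-pos x₁y≡ xy₁<x₁y in ≤-trans (*-mono-≤ 1≤D 1≤D) (m≤n+m _ _)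
    slack-from (inj₂ (above-strictly , 1≤y₁)) =
      ≤-trans (*-mono-≤ (excess-pos xx≡ above-strictly) (*-mono-≤ 1≤y₁ 1≤y₁)) (m≤m+n _ _)
  αDyy₁≤2Dxy₁ : α * D * y * y₁ ≤ 2 * D * x * y₁
  αDyy₁≤2Dxy₁ = begin
    α * D * y * y₁                  ≡⟨ regroup′ α D y y₁ ⟩
    D * (α * y) * y₁                ≤⟨ *-monoˡ-≤ y₁ (*-monoʳ-≤ D (above⇒αy≤x α β x y 1≤β 1≤y above)) ⟩
    D * x * y₁                      ≤⟨ m≤m+n (D * x * y₁) _ ⟩
    D * x * y₁ + (D * x * y₁ + 0)   ≡⟨ regroup″ D x y₁ ⟩
    2 * D * x * y₁                  ∎
    where
    regroup′ : ∀ α D y y₁ → α * D * y * y₁ ≡ D * (α * y) * y₁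
    regroup′ = solve-∀
    regroup″ : ∀ D x y₁ → D * x * y₁ + (D * x * y₁ + 0) ≡ 2 * D * x * y₁
    regroup″ = solve-∀
  regroup : ∀ q a b c → q + (a + b) + c ≡ q + a + c + b
  regroup = solve-∀

-- Both identities are F(x,y) y₁² - F(x₁,y₁) y² = (x y₁ - x₁ y) (x y₁ + x₁ y - α y y₁) for
-- F(x,y) = x² - α x y - β y², with the signs of F(x₁,y₁) and x y₁ - x₁ y fixed.
cross-identity : ∀ α β x y x₁ y₁ f f₁ e →
  x * x ≡ α * x * y + β * y * y + f → x₁ * x₁ ≡ α * x₁ * y₁ + β * y₁ * y₁ + f₁ → x * y₁ ≡ x₁ * y + e →
  f * (y₁ * y₁) + e * α * y * y₁ ≡ f₁ * (y * y) + e * (x * y₁ + x₁ * y)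
cross-identity α β x y x₁ y₁ f f₁ e xx≡ x₁x₁≡ xy₁≡ = +-cancelʳ-≡ base _ _ (trans lhs (sym rhs))
  where
  open ≡-Reasoning
  base = (α * x * y + β * y * y) * (y₁ * y₁)
  lhs : f * (y₁ * y₁) + e * α * y * y₁ + base ≡ (x₁ * y + e) * (x₁ * y + e) + e * α * y * y₁
  lhs = begin
    f * (y₁ * y₁) + e * α * y * y₁ + base ≡⟨ regroup₁ α β x y y₁ f e ⟩
    (α * x * y + β * y * y + f) * (y₁ * y₁) + e * α * y * y₁
      ≡⟨ cong (λ t → t * (y₁ * y₁) + e * α * y * y₁) (sym xx≡) ⟩
    (x * x) * (y₁ * y₁) + e * α * y * y₁ ≡⟨ regroup₂ x y₁ (e * α * y * y₁) ⟩
    (x * y₁) * (x * y₁) + e * α * y * y₁ ≡⟨ cong (λ t → t * t + e * α * y * y₁) xy₁≡ ⟩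
    (x₁ * y + e) * (x₁ * y + e) + e * α * y * y₁ ∎
    where
    regroup₁ : ∀ α β x y y₁ f e → f * (y₁ * y₁) + e * α * y * y₁ + (α * x * y + β * y * y) * (y₁ * y₁)
      ≡ (α * x * y + β * y * y + f) * (y₁ * y₁) + e * α * y * y₁
    regroup₁ = solve-∀
    regroup₂ : ∀ x y₁ k → (x * x) * (y₁ * y₁) + k ≡ (x * y₁) * (x * y₁) + k
    regroup₂ = solve-∀
  rhs : f₁ * (y * y) + e * (x * y₁ + x₁ * y) + base ≡ (x₁ * y + e) * (x₁ * y + e) + e * α * y * y₁
  rhs = begin
    f₁ * (y * y) + e * (x * y₁ + x₁ * y) + base ≡⟨ regroup₁ α β x y x₁ y₁ f₁ e ⟩
    f₁ * (y * y) + e * (x * y₁ + x₁ * y) + α * y * y₁ * (x * y₁) + β * y * y * (y₁ * y₁)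
      ≡⟨ cong (λ t → f₁ * (y * y) + e * (t + x₁ * y) + α * y * y₁ * t + β * y * y * (y₁ * y₁)) xy₁≡ ⟩
    f₁ * (y * y) + e * ((x₁ * y + e) + x₁ * y) + α * y * y₁ * (x₁ * y + e) + β * y * y * (y₁ * y₁)
      ≡⟨ regroup₂ α β x₁ y y₁ f₁ e ⟩
    (α * x₁ * y₁ + β * y₁ * y₁ + f₁) * (y * y) + e * (2 * (x₁ * y) + e) + α * y * y₁ * e
      ≡⟨ cong (λ t → t * (y * y) + e * (2 * (x₁ * y) + e) + α * y * y₁ * e) (sym x₁x₁≡) ⟩
    (x₁ * x₁) * (y * y) + e * (2 * (x₁ * y) + e) + α * y * y₁ * e ≡⟨ regroup₃ α x₁ y y₁ e ⟩
    (x₁ * y + e) * (x₁ * y + e) + e * α * y * y₁ ∎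
    where
    regroup₁ : ∀ α β x y x₁ y₁ f₁ e → f₁ * (y * y) + e * (x * y₁ + x₁ * y) + (α * x * y + β * y * y) * (y₁ * y₁)
       ≡ f₁ * (y * y) + e * (x * y₁ + x₁ * y) + α * y * y₁ * (x * y₁) + β * y * y * (y₁ * y₁)
    regroup₁ = solve-∀
    regroup₂ : ∀ α β x₁ y y₁ f₁ e → f₁ * (y * y) + e * ((x₁ * y + e) + x₁ * y) + α * y * y₁ * (x₁ * y + e) + β * y * y * (y₁ * y₁)
       ≡ (α * x₁ * y₁ + β * y₁ * y₁ + f₁) * (y * y) + e * (2 * (x₁ * y) + e) + α * y * y₁ * e
    regroup₂ = solve-∀
    regroup₃ : ∀ α x₁ y y₁ e → (x₁ * x₁) * (y * y) + e * (2 * (x₁ * y) + e) + α * y * y₁ * e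
      ≡ (x₁ * y + e) * (x₁ * y + e) + e * α * y * y₁
    regroup₃ = solve-∀

cross-identity′ : ∀ α β x y x₁ y₁ f f₁ e →
  x * x ≡ α * x * y + β * y * y + f → x₁ * x₁ + f₁ ≡ α * x₁ * y₁ + β * y₁ * y₁ → x * y₁ ≡ x₁ * y + e →
  f * (y₁ * y₁) + f₁ * (y * y) + e * α * y * y₁ ≡ e * (x * y₁ + x₁ * y)
cross-identity′ α β x y x₁ y₁ f f₁ e xx≡ x₁x₁≡ xy₁≡ = +-cancelʳ-≡ base _ _ (trans lhs (sym rhs))
  where
  open ≡-Reasoning
  base = (α * x * y + β * y * y) * (y₁ * y₁) + x₁ * x₁ * (y * y)
  lhs : f * (y₁ * y₁) + f₁ * (y * y) + e * α * y * y₁ + base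
    ≡ (x₁ * y + e) * (x₁ * y + e) + α * y * y₁ * (x₁ * y) + β * y * y * (y₁ * y₁) + e * α * y * y₁
  lhs = begin
    f * (y₁ * y₁) + f₁ * (y * y) + e * α * y * y₁ + base ≡⟨ regroup₁ α β x y x₁ y₁ f f₁ e ⟩
    (α * x * y + β * y * y + f) * (y₁ * y₁) + (x₁ * x₁ + f₁) * (y * y) + e * α * y * y₁
      ≡⟨ cong₂ (λ t u → t * (y₁ * y₁) + u * (y * y) + e * α * y * y₁) (sym xx≡) x₁x₁≡ ⟩
    (x * x) * (y₁ * y₁) + (α * x₁ * y₁ + β * y₁ * y₁) * (y * y) + e * α * y * y₁ ≡⟨ regroup₂ α β x y x₁ y₁ e ⟩
    (x * y₁) * (x * y₁) + α * y * y₁ * (x₁ * y) + β * y * y * (y₁ * y₁) + e * α * y * y₁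
      ≡⟨ cong (λ t → t * t + α * y * y₁ * (x₁ * y) + β * y * y * (y₁ * y₁) + e * α * y * y₁) xy₁≡ ⟩
    (x₁ * y + e) * (x₁ * y + e) + α * y * y₁ * (x₁ * y) + β * y * y * (y₁ * y₁) + e * α * y * y₁ ∎
    where
    regroup₁ : ∀ α β x y x₁ y₁ f f₁ e → f * (y₁ * y₁) + f₁ * (y * y) + e * α * y * y₁ + ((α * x * y + β * y * y) * (y₁ * y₁) + x₁ * x₁ * (y * y))
       ≡ (α * x * y + β * y * y + f) * (y₁ * y₁) + (x₁ * x₁ + f₁) * (y * y) + e * α * y * y₁
    regroup₁ = solve-∀
    regroup₂ : ∀ α β x y x₁ y₁ e → (x * x) * (y₁ * y₁) + (α * x₁ * y₁ + β * y₁ * y₁) * (y * y) + e * α * y * y₁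
       ≡ (x * y₁) * (x * y₁) + α * y * y₁ * (x₁ * y) + β * y * y * (y₁ * y₁) + e * α * y * y₁
    regroup₂ = solve-∀
  rhs : e * (x * y₁ + x₁ * y) + base
    ≡ (x₁ * y + e) * (x₁ * y + e) + α * y * y₁ * (x₁ * y) + β * y * y * (y₁ * y₁) + e * α * y * y₁
  rhs = begin
    e * (x * y₁ + x₁ * y) + base ≡⟨ regroup₁ α β x y x₁ y₁ e ⟩
    e * (x * y₁ + x₁ * y) + α * y * y₁ * (x * y₁) + β * y * y * (y₁ * y₁) + x₁ * x₁ * (y * y)
      ≡⟨ cong (λ t → e * (t + x₁ * y) + α * y * y₁ * t + β * y * y * (y₁ * y₁) + x₁ * x₁ * (y * y)) xy₁≡ ⟩
    e * ((x₁ * y + e) + x₁ * y) + α * y * y₁ * (x₁ * y + e) + β * y * y * (y₁ * y₁) + x₁ * x₁ * (y * y)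
      ≡⟨ regroup₂ α β x₁ y y₁ e ⟩
    (x₁ * y + e) * (x₁ * y + e) + α * y * y₁ * (x₁ * y) + β * y * y * (y₁ * y₁) + e * α * y * y₁ ∎
    where
    regroup₁ : ∀ α β x y x₁ y₁ e → e * (x * y₁ + x₁ * y) + ((α * x * y + β * y * y) * (y₁ * y₁) + x₁ * x₁ * (y * y))
       ≡ e * (x * y₁ + x₁ * y) + α * y * y₁ * (x * y₁) + β * y * y * (y₁ * y₁) + x₁ * x₁ * (y * y)
    regroup₁ = solve-∀
    regroup₂ : ∀ α β x₁ y y₁ e → e * ((x₁ * y + e) + x₁ * y) + α * y * y₁ * (x₁ * y + e) + β * y * y * (y₁ * y₁) + x₁ * x₁ * (y * y)
       ≡ (x₁ * y + e) * (x₁ * y + e) + α * y * y₁ * (x₁ * y) + β * y * y * (y₁ * y₁) + e * α * y * y₁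
    regroup₂ = solve-∀

-- When (α,β) - (α',β') = (c,-d) or (-c,d) has mixed signs, the two quadratic forms agree at
-- d / c, whose denominator is at most M; cross-identity shows that a / B, which lies just
-- above γ_{α',β'}, cannot come close to d / c unless B is small.
module Separation (α' β' α β a₀ b₀ a B M : ℕ)
  (1≤α' : 1 ≤ α') (1≤β' : 1 ≤ β') (1≤β : 1 ≤ β)
  (α≤M : α ≤ M) (β≤M : β ≤ M) (s≤M : α' + β' ≤ M) (1≤b₀ : 1 ≤ b₀)
  (γ'<a₀/b₀ : α' * a₀ * b₀ + β' * b₀ * b₀ < a₀ * a₀) (a₀/b₀<γ : a₀ * a₀ < α * a₀ * b₀ + β * b₀ * b₀)
  (8M³≤B : 8 * (M * M * M) ≤ B)
  (γ'<a/B : α' * a * B + β' * B * B < a * a)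
  (a/B-least : a * a < α' * a * B + β' * B * B + 2 * a)
  (a≤sB : a ≤ (α' + β') * B)
  where

  open ≤-Reasoning

  s = α' + β'
  P = α' * a * B + β' * B * B
  M³ = M * M * M
  f = proj₁ (<⇒excess γ'<a/B)

  aa≡P+f : a * a ≡ P + f
  aa≡P+f = proj₁ (proj₂ (<⇒excess γ'<a/B))

  f<2a : f < 2 * a
  f<2a = +-cancelˡ-< P f (2 * a) (subst (_< P + 2 * a) aa≡P+f a/B-least)

  f<2sB : f < 2 * s * B
  f<2sB = <-≤-trans f<2a (≤-trans (*-monoʳ-≤ 2 a≤sB) (≤-reflexive (sym (*-assoc 2 s B))))

  1≤s : 1 ≤ s
  1≤s = ≤-trans 1≤α' (m≤m+n α' β')

  1≤M : 1 ≤ M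
  1≤M = ≤-trans 1≤s s≤M

  M≤M³ : M ≤ M³
  M≤M³ = m≤n*m M (M * M) {{>-nonZero (*-mono-≤ 1≤M 1≤M)}}

  2s≤B : 2 * s ≤ B
  2s≤B = ≤-trans (*-monoʳ-≤ 2 (≤-trans s≤M M≤M³)) (≤-trans (*-monoˡ-≤ M³ (s≤s (s≤s (z≤n {6})))) 8M³≤B)

  2≤B : 2 ≤ B
  2≤B = ≤-trans (*-monoʳ-≤ 2 1≤s) 2s≤B

  1≤B : 1 ≤ B
  1≤B = ≤-trans (s≤s z≤n) 2≤B

  B-small : ∀ X → X < 8 * M³ → B * B ≤ X * B → ⊥
  B-small X X<8M³ BB≤XB = <-irrefl refl (<-≤-trans (≤-<-trans (*-cancelʳ-≤ B X B {{>-nonZero 1≤B}} BB≤XB) X<8M³) 8M³≤B)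

  below-by : ∀ X → f < X → P + X ≤ α * a * B + β * B * B → a * a < α * a * B + β * B * B
  below-by X f<X P+X≤ = <-≤-trans (subst (_< P + X) (sym aa≡P+f) (+-monoʳ-< P f<X)) P+X≤

  separation-≥ : ∀ c d → α ≡ α' + c → β ≡ β' + d → 1 ≤ c ⊎ 1 ≤ d → a * a < α * a * B + β * B * B
  separation-≥ c d α≡α'+c β≡β'+d c⊎d = below-by (c * a * B + d * B * B) (f<cross c⊎d)
    (≤-reflexive (trans (regroup α' β' a B c d) (sym (cong₂ (λ u v → u * a * B + v * B * B) α≡α'+c β≡β'+d))))
    where
    regroup : ∀ α' β' a B c d → α' * a * B + β' * B * B + (c * a * B + d * B * B) ≡ (α' + c) * a * B + (β' + d) * B * B
    regroup = solve-∀
    f<cross : 1 ≤ c ⊎ 1 ≤ d → f < c * a * B + d * B * B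
    f<cross (inj₁ 1≤c) = <-≤-trans f<2a (≤-trans (begin
      2 * a       ≡⟨ *-comm 2 a ⟩
      a * 2       ≤⟨ *-monoʳ-≤ a 2≤B ⟩
      a * B       ≤⟨ m≤n*m (a * B) c {{>-nonZero 1≤c}} ⟩
      c * (a * B) ≡⟨ *-assoc c a B ⟨
      c * a * B   ∎) (m≤m+n _ _))
    f<cross (inj₂ 1≤d) = <-≤-trans f<2sB (≤-trans (begin
      2 * s * B   ≤⟨ *-monoˡ-≤ B 2s≤B ⟩
      B * B       ≤⟨ m≤n*m (B * B) d {{>-nonZero 1≤d}} ⟩
      d * (B * B) ≡⟨ *-assoc d B B ⟨
      d * B * B   ∎) (m≤n+m _ _))

  not-both-≤ : α ≤ α' → β ≤ β' → ⊥
  not-both-≤ α≤α' β≤β' = <-irrefl refl (<-trans a₀/b₀<γ (≤-<-trans F≤F' γ'<a₀/b₀))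
    where
    F≤F' : α * a₀ * b₀ + β * b₀ * b₀ ≤ α' * a₀ * b₀ + β' * b₀ * b₀
    F≤F' = +-mono-≤ (*-monoˡ-≤ b₀ (*-monoˡ-≤ a₀ α≤α')) (*-monoˡ-≤ b₀ (*-monoˡ-≤ b₀ β≤β'))

  module LargerAlpha (c d : ℕ) (α≡α'+c : α ≡ α' + c) (β'≡β+d : β' ≡ β + d)
    (1≤c : 1 ≤ c) (1≤d : 1 ≤ d) (c≤M : c ≤ M) where

    db₀<a₀c : d * b₀ < a₀ * c
    db₀<a₀c = subst (d * b₀ <_) (*-comm c a₀) (*-cancelʳ-< b₀ _ _ (+-cancelˡ-< (α' * a₀ * b₀ + β * b₀ * b₀) _ _ (begin-strict
      α' * a₀ * b₀ + β * b₀ * b₀ + d * b₀ * b₀   ≡⟨ regroup₁ α' β d a₀ b₀ ⟩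
      α' * a₀ * b₀ + (β + d) * b₀ * b₀           ≡⟨ cong (λ t → α' * a₀ * b₀ + t * b₀ * b₀) β'≡β+d ⟨
      α' * a₀ * b₀ + β' * b₀ * b₀                <⟨ <-trans γ'<a₀/b₀ a₀/b₀<γ ⟩
      α * a₀ * b₀ + β * b₀ * b₀                  ≡⟨ cong (λ t → t * a₀ * b₀ + β * b₀ * b₀) α≡α'+c ⟩
      (α' + c) * a₀ * b₀ + β * b₀ * b₀           ≡⟨ regroup₂ α' β c a₀ b₀ ⟩
      α' * a₀ * b₀ + β * b₀ * b₀ + c * a₀ * b₀   ∎)))
      where
      regroup₁ : ∀ α' β d a₀ b₀ → α' * a₀ * b₀ + β * b₀ * b₀ + d * b₀ * b₀ ≡ α' * a₀ * b₀ + (β + d) * b₀ * b₀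
      regroup₁ = solve-∀
      regroup₂ : ∀ α' β c a₀ b₀ → (α' + c) * a₀ * b₀ + β * b₀ * b₀ ≡ α' * a₀ * b₀ + β * b₀ * b₀ + c * a₀ * b₀
      regroup₂ = solve-∀

    forms-agree : α * d * c + β * c * c ≡ α' * d * c + β' * c * c
    forms-agree = trans (cong (λ u → u * d * c + β * c * c) α≡α'+c)
      (trans (regroup α' β c d) (cong (λ t → α' * d * c + t * c * c) (sym β'≡β+d)))
      where
      regroup : ∀ α' β c d → (α' + c) * d * c + β * c * c ≡ α' * d * c + (β + d) * c * c
      regroup = solve-∀

    -- Otherwise γ_{α,β} ≤ d / c < a₀ / b₀ by forms-agree.
    d/c<γ' : d * d < α' * d * c + β' * c * c
    d/c<γ' with d * d <? α' * d * c + β' * c * c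
    ... | yes below = below
    ... | no ¬below = ⊥-elim (<-asym a₀/b₀<γ (above-mono α β d c a₀ b₀ 1≤β 1≤c
            (subst (_≤ d * d) (sym forms-agree) (≮⇒≥ ¬below)) (<⇒≤ db₀<a₀c) (inj₁ db₀<a₀c)))

    dB<ca : d * B < c * a
    dB<ca with c * a ≤? d * B
    ... | no ca≰dB = ≰⇒> ca≰dB
    ... | yes ca≤dB = ⊥-elim (<-irrefl refl dBb₀<dBb₀)
      where
      a/B<γ : α * a * B + β * B * B < a * a
      a/B<γ = begin-strict
        α * a * B + β * B * B                    ≡⟨ cong (λ t → t * a * B + β * B * B) α≡α'+c ⟩
        (α' + c) * a * B + β * B * B             ≡⟨ regroup₁ α' β c a B ⟩
        α' * a * B + β * B * B + (c * a) * B     ≤⟨ +-monoʳ-≤ _ (*-monoˡ-≤ B ca≤dB) ⟩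
        α' * a * B + β * B * B + (d * B) * B     ≡⟨ regroup₂ α' β d a B ⟩
        α' * a * B + (β + d) * B * B             ≡⟨ cong (λ t → α' * a * B + t * B * B) β'≡β+d ⟨
        P                                        <⟨ γ'<a/B ⟩
        a * a                                    ∎
        where
        regroup₁ : ∀ α' β c a B → (α' + c) * a * B + β * B * B ≡ α' * a * B + β * B * B + (c * a) * B
        regroup₁ = solve-∀
        regroup₂ : ∀ α' β d a B → α' * a * B + β * B * B + (d * B) * B ≡ α' * a * B + (β + d) * B * B
        regroup₂ = solve-∀
      a₀B<ab₀ : a₀ * B < a * b₀
      a₀B<ab₀ with a * b₀ ≤? a₀ * B
      ... | no ab₀≰a₀B = ≰⇒> ab₀≰a₀B
      ... | yes ab₀≤a₀B = ⊥-elim (<-asym a₀/b₀<γ (above-mono α β a B a₀ b₀ 1≤β 1≤B (<⇒≤ a/B<γ) ab₀≤a₀B (inj₂ (a/B<γ , 1≤b₀))))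
      dBb₀<dBb₀ : d * B * b₀ < d * B * b₀
      dBb₀<dBb₀ = begin-strict
        d * B * b₀     ≡⟨ regroup d B b₀ ⟩
        (d * b₀) * B   <⟨ *-monoˡ-< B {{>-nonZero 1≤B}} (subst (d * b₀ <_) (*-comm a₀ c) db₀<a₀c) ⟩
        (c * a₀) * B   ≡⟨ *-assoc c a₀ B ⟩
        c * (a₀ * B)   ≤⟨ *-monoʳ-≤ c (<⇒≤ a₀B<ab₀) ⟩
        c * (a * b₀)   ≡⟨ *-assoc c a b₀ ⟨
        (c * a) * b₀   ≤⟨ *-monoˡ-≤ b₀ ca≤dB ⟩
        d * B * b₀     ∎
        where
        regroup : ∀ d B b₀ → d * B * b₀ ≡ (d * b₀) * B
        regroup = solve-∀

    e = proj₁ (≤⇒excess (<⇒≤ dB<ca))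

    ca≡dB+e : c * a ≡ d * B + e
    ca≡dB+e = proj₂ (≤⇒excess (<⇒≤ dB<ca))

    2s≤e : 2 * s ≤ e
    2s≤e with 2 * s ≤? e
    ... | yes 2s≤e = 2s≤e
    ... | no 2s≰e = ⊥-elim (B-small (e * (2 * s * c)) e2sc<8M³ BB≤e2scB)
      where
      f₂ = proj₁ (<⇒excess d/c<γ')
      1≤f₂ = proj₂ (proj₂ (<⇒excess d/c<γ'))
      identity : f * (c * c) + f₂ * (B * B) + e * α' * B * c ≡ e * (a * c + d * B)
      identity = cross-identity′ α' β' a B d c f f₂ e aa≡P+f (sym (proj₁ (proj₂ (<⇒excess d/c<γ'))))
                   (trans (*-comm a c) ca≡dB+e)
      BB≤e2scB : B * B ≤ e * (2 * s * c) * B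
      BB≤e2scB = begin
        B * B                                      ≤⟨ m≤n*m (B * B) f₂ {{>-nonZero 1≤f₂}} ⟩
        f₂ * (B * B)                               ≤⟨ m≤n+m _ (f * (c * c)) ⟩
        f * (c * c) + f₂ * (B * B)                 ≤⟨ m≤m+n _ (e * α' * B * c) ⟩
        f * (c * c) + f₂ * (B * B) + e * α' * B * c ≡⟨ identity ⟩
        e * (a * c + d * B)                        ≤⟨ *-monoʳ-≤ e (+-monoʳ-≤ (a * c) (≤-trans (m≤m+n (d * B) e) (≤-reflexive (sym (trans (*-comm a c) ca≡dB+e))))) ⟩
        e * (a * c + a * c)                        ≤⟨ *-monoʳ-≤ e (+-mono-≤ (*-monoˡ-≤ c a≤sB) (*-monoˡ-≤ c a≤sB)) ⟩
        e * (s * B * c + s * B * c)                ≡⟨ regroup e s B c ⟩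
        e * (2 * s * c) * B                        ∎
        where
        regroup : ∀ e s B c → e * (s * B * c + s * B * c) ≡ e * (2 * s * c) * B
        regroup = solve-∀
      e2sc<8M³ : e * (2 * s * c) < 8 * M³
      e2sc<8M³ = begin-strict
        e * (2 * s * c)          <⟨ *-monoˡ-< (2 * s * c) {{>-nonZero (*-mono-≤ (*-mono-≤ (s≤s (z≤n {1})) 1≤s) 1≤c)}} (≰⇒> 2s≰e) ⟩
        2 * s * (2 * s * c)      ≤⟨ *-mono-≤ (*-monoʳ-≤ 2 s≤M) (*-mono-≤ (*-monoʳ-≤ 2 s≤M) c≤M) ⟩
        2 * M * (2 * M * M)      ≡⟨ regroup M ⟩
        4 * M³                   ≤⟨ *-monoˡ-≤ M³ (s≤s (s≤s (s≤s (s≤s (z≤n {4}))))) ⟩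
        8 * M³                   ∎
        where
        regroup : ∀ M → 2 * M * (2 * M * M) ≡ 4 * (M * M * M)
        regroup = solve-∀

    separation-larger-α : a * a < α * a * B + β * B * B
    separation-larger-α = below-by (e * B) (<-≤-trans f<2sB (*-monoˡ-≤ B 2s≤e)) (≤-reflexive (begin-equality
      P + e * B                               ≡⟨ cong (λ t → α' * a * B + t * B * B + e * B) β'≡β+d ⟩
      α' * a * B + (β + d) * B * B + e * B    ≡⟨ regroup₁ α' β d a B e ⟩
      α' * a * B + (d * B + e) * B + β * B * B ≡⟨ cong (λ t → α' * a * B + t * B + β * B * B) ca≡dB+e ⟨
      α' * a * B + (c * a) * B + β * B * B    ≡⟨ regroup₂ α' β c a B ⟩
      (α' + c) * a * B + β * B * B            ≡⟨ cong (λ t → t * a * B + β * B * B) α≡α'+c ⟨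
      α * a * B + β * B * B                   ∎))
      where
      regroup₁ : ∀ α' β d a B e → α' * a * B + (β + d) * B * B + e * B ≡ α' * a * B + (d * B + e) * B + β * B * B
      regroup₁ = solve-∀
      regroup₂ : ∀ α' β c a B → α' * a * B + (c * a) * B + β * B * B ≡ (α' + c) * a * B + β * B * B
      regroup₂ = solve-∀

  module LargerBeta (c d : ℕ) (α'≡α+c : α' ≡ α + c) (β≡β'+d : β ≡ β' + d)
    (1≤c : 1 ≤ c) (1≤d : 1 ≤ d) (c≤M : c ≤ M) (d≤M : d ≤ M) where

    a₀c<db₀ : a₀ * c < d * b₀
    a₀c<db₀ = subst (_< d * b₀) (*-comm c a₀) (*-cancelʳ-< b₀ _ _ (+-cancelˡ-< (α * a₀ * b₀ + β' * b₀ * b₀) _ _ (begin-strict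
      α * a₀ * b₀ + β' * b₀ * b₀ + c * a₀ * b₀   ≡⟨ regroup₁ α β' c a₀ b₀ ⟩
      (α + c) * a₀ * b₀ + β' * b₀ * b₀           ≡⟨ cong (λ t → t * a₀ * b₀ + β' * b₀ * b₀) α'≡α+c ⟨
      α' * a₀ * b₀ + β' * b₀ * b₀                <⟨ <-trans γ'<a₀/b₀ a₀/b₀<γ ⟩
      α * a₀ * b₀ + β * b₀ * b₀                  ≡⟨ cong (λ t → α * a₀ * b₀ + t * b₀ * b₀) β≡β'+d ⟩
      α * a₀ * b₀ + (β' + d) * b₀ * b₀           ≡⟨ regroup₂ α β' d a₀ b₀ ⟩
      α * a₀ * b₀ + β' * b₀ * b₀ + d * b₀ * b₀   ∎)))
      where
      regroup₁ : ∀ α β' c a₀ b₀ → α * a₀ * b₀ + β' * b₀ * b₀ + c * a₀ * b₀ ≡ (α + c) * a₀ * b₀ + β' * b₀ * b₀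
      regroup₁ = solve-∀
      regroup₂ : ∀ α β' d a₀ b₀ → α * a₀ * b₀ + (β' + d) * b₀ * b₀ ≡ α * a₀ * b₀ + β' * b₀ * b₀ + d * b₀ * b₀
      regroup₂ = solve-∀

    γ'<d/c : α' * d * c + β' * c * c < d * d
    γ'<d/c = above-mono α' β' a₀ b₀ d c 1≤β' 1≤b₀ (<⇒≤ γ'<a₀/b₀) (<⇒≤ a₀c<db₀) (inj₁ a₀c<db₀)

    f₃ = proj₁ (<⇒excess γ'<d/c)

    dd≡ : d * d ≡ α' * d * c + β' * c * c + f₃
    dd≡ = proj₁ (proj₂ (<⇒excess γ'<d/c))

    BB≤f₃BB : B * B ≤ f₃ * (B * B)
    BB≤f₃BB = m≤n*m (B * B) f₃ {{>-nonZero (proj₂ (proj₂ (<⇒excess γ'<d/c)))}}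

    2scc≤2M³ : 2 * s * (c * c) ≤ 2 * M³
    2scc≤2M³ = ≤-trans (*-mono-≤ (*-monoʳ-≤ 2 s≤M) (*-mono-≤ c≤M c≤M)) (≤-reflexive (regroup M))
      where
      regroup : ∀ M → 2 * M * (M * M) ≡ 2 * (M * M * M)
      regroup = solve-∀

    1≤M³ : 1 ≤ M³
    1≤M³ = *-mono-≤ (*-mono-≤ 1≤M 1≤M) 1≤M

    ca<dB : c * a < d * B
    ca<dB with d * B ≤? c * a
    ... | no dB≰ca = ≰⇒> dB≰ca
    ... | yes dB≤ca = ⊥-elim (B-small (2 * s * (c * c))
          (≤-<-trans 2scc≤2M³ (*-monoˡ-< M³ {{>-nonZero 1≤M³}} (s≤s (s≤s (s≤s (z≤n {5}))))))
          BB≤2sccB)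
      where
      e₁ = proj₁ (≤⇒excess dB≤ca)
      ca≡dB+e₁ : c * a ≡ d * B + e₁
      ca≡dB+e₁ = proj₂ (≤⇒excess dB≤ca)
      identity : f * (c * c) + e₁ * α' * B * c ≡ f₃ * (B * B) + e₁ * (a * c + d * B)
      identity = cross-identity α' β' a B d c f f₃ e₁ aa≡P+f dd≡ (trans (*-comm a c) ca≡dB+e₁)
      e₁α'Bc≤ : e₁ * α' * B * c ≤ e₁ * (a * c + d * B)
      e₁α'Bc≤ = ≤-trans (≤-reflexive (regroup e₁ α' B c))
        (*-monoʳ-≤ e₁ (≤-trans (*-monoˡ-≤ c (above⇒αy≤x α' β' a B 1≤β' 1≤B (<⇒≤ γ'<a/B))) (m≤m+n (a * c) (d * B))))
        where
        regroup : ∀ e α B c → e * α * B * c ≡ e * (α * B * c)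
        regroup = solve-∀
      BB≤2sccB : B * B ≤ 2 * s * (c * c) * B
      BB≤2sccB = begin
        B * B                 ≤⟨ BB≤f₃BB ⟩
        f₃ * (B * B)          ≤⟨ +-cancelʳ-≤ (e₁ * α' * B * c) _ _ (≤-trans (+-monoʳ-≤ (f₃ * (B * B)) e₁α'Bc≤) (≤-reflexive (sym identity))) ⟩
        f * (c * c)           ≤⟨ *-monoˡ-≤ (c * c) (<⇒≤ f<2sB) ⟩
        2 * s * B * (c * c)   ≡⟨ regroup s B c ⟩
        2 * s * (c * c) * B   ∎
        where
        regroup : ∀ s B c → 2 * s * B * (c * c) ≡ 2 * s * (c * c) * B
        regroup = solve-∀

    e = proj₁ (≤⇒excess (<⇒≤ ca<dB))

    dB≡ca+e : d * B ≡ c * a + e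
    dB≡ca+e = proj₂ (≤⇒excess (<⇒≤ ca<dB))

    2s≤e : 2 * s ≤ e
    2s≤e with 2 * s ≤? e
    ... | yes 2s≤e = 2s≤e
    ... | no 2s≰e = ⊥-elim (B-small (2 * s * (c * c) + 2 * e * d) bound BB≤XB)
      where
      e<2s = ≰⇒> 2s≰e
      identity : f₃ * (B * B) + e * α' * c * B ≡ f * (c * c) + e * (d * B + a * c)
      identity = cross-identity α' β' d c a B f₃ f e dd≡ aa≡P+f (trans dB≡ca+e (cong (_+ e) (*-comm c a)))
      ac≤dB : a * c ≤ d * B
      ac≤dB = subst (_≤ d * B) (*-comm c a) (subst (c * a ≤_) (sym dB≡ca+e) (m≤m+n (c * a) e))
      BB≤XB : B * B ≤ (2 * s * (c * c) + 2 * e * d) * B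
      BB≤XB = begin
        B * B                                   ≤⟨ BB≤f₃BB ⟩
        f₃ * (B * B)                            ≤⟨ m≤m+n _ _ ⟩
        f₃ * (B * B) + e * α' * c * B           ≡⟨ identity ⟩
        f * (c * c) + e * (d * B + a * c)       ≤⟨ +-mono-≤ (*-monoˡ-≤ (c * c) (<⇒≤ f<2sB)) (*-monoʳ-≤ e (+-monoʳ-≤ (d * B) ac≤dB)) ⟩
        2 * s * B * (c * c) + e * (d * B + d * B) ≡⟨ regroup s B c e d ⟩
        (2 * s * (c * c) + 2 * e * d) * B       ∎
        where
        regroup : ∀ s B c e d → 2 * s * B * (c * c) + e * (d * B + d * B) ≡ (2 * s * (c * c) + 2 * e * d) * B
        regroup = solve-∀
      bound : 2 * s * (c * c) + 2 * e * d < 8 * M³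
      bound = begin-strict
        2 * s * (c * c) + 2 * e * d         <⟨ +-monoʳ-< (2 * s * (c * c)) (*-monoˡ-< d {{>-nonZero 1≤d}} (*-monoʳ-< 2 e<2s)) ⟩
        2 * s * (c * c) + 2 * (2 * s) * d   ≤⟨ +-mono-≤ 2scc≤2M³ (*-mono-≤ (*-monoʳ-≤ 2 (*-monoʳ-≤ 2 s≤M)) d≤M) ⟩
        2 * M³ + 2 * (2 * M) * M            ≡⟨ cong (2 * M³ +_) (regroup₁ M) ⟩
        2 * M³ + 4 * (M * M)                ≤⟨ +-monoʳ-≤ (2 * M³) (*-monoʳ-≤ 4 (m≤m*n (M * M) M {{>-nonZero 1≤M}})) ⟩
        2 * M³ + 4 * (M * M * M)            ≡⟨ regroup₂ M ⟩
        6 * M³                              ≤⟨ *-monoˡ-≤ M³ (s≤s (s≤s (s≤s (s≤s (s≤s (s≤s (z≤n {2}))))))) ⟩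
        8 * M³                              ∎
        where
        regroup₁ : ∀ M → 2 * (2 * M) * M ≡ 4 * (M * M)
        regroup₁ = solve-∀
        regroup₂ : ∀ M → 2 * (M * M * M) + 4 * (M * M * M) ≡ 6 * (M * M * M)
        regroup₂ = solve-∀

    separation-larger-β : a * a < α * a * B + β * B * B
    separation-larger-β = below-by (e * B) (<-≤-trans f<2sB (*-monoˡ-≤ B 2s≤e)) (≤-reflexive (begin-equality
      P + e * B                               ≡⟨ cong (λ t → t * a * B + β' * B * B + e * B) α'≡α+c ⟩
      (α + c) * a * B + β' * B * B + e * B    ≡⟨ regroup₁ α β' c a B e ⟩
      α * a * B + β' * B * B + (c * a + e) * B ≡⟨ cong (λ t → α * a * B + β' * B * B + t * B) dB≡ca+e ⟨
      α * a * B + β' * B * B + (d * B) * B    ≡⟨ regroup₂ α β' d a B ⟩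
      α * a * B + (β' + d) * B * B            ≡⟨ cong (λ t → α * a * B + t * B * B) β≡β'+d ⟨
      α * a * B + β * B * B                   ∎))
      where
      regroup₁ : ∀ α β' c a B e → (α + c) * a * B + β' * B * B + e * B ≡ α * a * B + β' * B * B + (c * a + e) * B
      regroup₁ = solve-∀
      regroup₂ : ∀ α β' d a B → α * a * B + β' * B * B + (d * B) * B ≡ α * a * B + (β' + d) * B * B
      regroup₂ = solve-∀

  separation : a * a < α * a * B + β * B * B
  separation with <-cmp α' α | <-cmp β' β
  ... | tri< α'<α _ _ | tri< β'<β _ _ = separation-≥ _ _ (≡+∸ α'<α) (≡+∸ β'<β) (inj₁ (m<n⇒0<n∸m α'<α))
  ... | tri< α'<α _ _ | tri≈ _ refl _ = separation-≥ _ 0 (≡+∸ α'<α) (sym (+-identityʳ β)) (inj₁ (m<n⇒0<n∸m α'<α))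
  ... | tri< α'<α _ _ | tri> _ _ β<β' =
    LargerAlpha.separation-larger-α _ _ (≡+∸ α'<α) (≡+∸ β<β') (m<n⇒0<n∸m α'<α) (m<n⇒0<n∸m β<β') (≤-trans (m∸n≤m α α') α≤M)
  ... | tri≈ _ refl _ | tri< β'<β _ _ = separation-≥ 0 _ (sym (+-identityʳ α)) (≡+∸ β'<β) (inj₂ (m<n⇒0<n∸m β'<β))
  ... | tri≈ _ refl _ | tri≈ _ refl _ = ⊥-elim (not-both-≤ ≤-refl ≤-refl)
  ... | tri≈ _ refl _ | tri> _ _ β<β' = ⊥-elim (not-both-≤ ≤-refl (<⇒≤ β<β'))
  ... | tri> _ _ α<α' | tri< β'<β _ _ =
    LargerBeta.separation-larger-β _ _ (≡+∸ α<α') (≡+∸ β'<β) (m<n⇒0<n∸m α<α') (m<n⇒0<n∸m β'<β)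
      (≤-trans (m∸n≤m α' α) (≤-trans (m≤m+n α' β') s≤M)) (≤-trans (m∸n≤m β β') β≤M)
  ... | tri> _ _ α<α' | tri≈ _ refl _ = ⊥-elim (not-both-≤ (<⇒≤ α<α') ≤-refl)
  ... | tri> _ _ α<α' | tri> _ _ β<β' = ⊥-elim (not-both-≤ (<⇒≤ α<α') (<⇒≤ β<β'))

least : ∀ {Q : ℕ → Set} → (∀ x → Dec (Q x)) → ¬ Q 0 → ∀ K → Q K → Σ ℕ λ a → Q a × ¬ Q (pred a) × a ≤ K
least Q? ¬Q0 zero Q0 = ⊥-elim (¬Q0 Q0)
least Q? ¬Q0 (suc K) Q1+K with Q? K
... | no ¬QK = suc K , Q1+K , ¬QK , ≤-refl
... | yes QK = let a , Qa , ¬Qa-1 , a≤K = least Q? ¬Q0 K QK in a , Qa , ¬Qa-1 , m≤n⇒m≤1+n a≤K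

least-fraction-above : ∀ α β B → 1 ≤ α → 1 ≤ β → 1 ≤ B → Σ ℕ λ a →
  (α * a * B + β * B * B < a * a) × (a * a < α * a * B + β * B * B + 2 * a) × (a ≤ (α + β) * B) × (1 ≤ a)
least-fraction-above α β B 1≤α 1≤β 1≤B =
  let a , above , ¬above , a≤sB = least (λ x → α * x * B + β * B * B <? x * x) (λ ()) (s * B) sB-above
  in a , above , least-close a above ¬above , a≤sB , 1≤a a above
  where
  open ≤-Reasoning
  s = α + β
  s-above : α * s + β < s * s
  s-above = begin-strict
    α * s + β        <⟨ +-monoʳ-< (α * s) (subst (_< β * s) (*-identityʳ β) (*-monoʳ-< β {{>-nonZero 1≤β}} (+-mono-≤ 1≤α 1≤β))) ⟩
    α * s + β * s    ≡⟨ *-distribʳ-+ s α β ⟨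
    s * s            ∎
  sB-above : α * (s * B) * B + β * B * B < s * B * (s * B)
  sB-above = begin-strict
    α * (s * B) * B + β * B * B   ≡⟨ regroup₁ α β s B ⟩
    (α * s + β) * (B * B)         <⟨ *-monoˡ-< (B * B) {{>-nonZero (*-mono-≤ 1≤B 1≤B)}} s-above ⟩
    s * s * (B * B)               ≡⟨ regroup₂ s B ⟩
    s * B * (s * B)               ∎
    where
    regroup₁ : ∀ α β s B → α * (s * B) * B + β * B * B ≡ (α * s + β) * (B * B)
    regroup₁ = solve-∀
    regroup₂ : ∀ s B → s * s * (B * B) ≡ s * B * (s * B)
    regroup₂ = solve-∀
  1≤a : ∀ a → α * a * B + β * B * B < a * a → 1 ≤ a
  1≤a zero ()
  1≤a (suc a) _ = s≤s z≤n
  least-close : ∀ a → α * a * B + β * B * B < a * a → ¬ (α * pred a * B + β * B * B < pred a * pred a) →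
    a * a < α * a * B + β * B * B + 2 * a
  least-close zero () _
  least-close (suc x) _ ¬above = begin-strict
    suc x * suc x                                ≡⟨ square x ⟩
    x * x + (2 * x + 1)                          ≤⟨ +-monoˡ-≤ (2 * x + 1) (≮⇒≥ ¬above) ⟩
    α * x * B + β * B * B + (2 * x + 1)          <⟨ +-monoʳ-< (α * x * B + β * B * B) (+-monoʳ-< (2 * x) (s≤s (s≤s z≤n))) ⟩
    α * x * B + β * B * B + (2 * x + 2)          ≤⟨ +-monoˡ-≤ (2 * x + 2) (+-monoˡ-≤ (β * B * B) (*-monoˡ-≤ B (*-monoʳ-≤ α (n≤1+n x)))) ⟩
    α * suc x * B + β * B * B + (2 * x + 2)      ≡⟨ cong (α * suc x * B + β * B * B +_) (double x) ⟩
    α * suc x * B + β * B * B + 2 * suc x        ∎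
    where
    square : ∀ x → (1 + x) * (1 + x) ≡ x * x + (2 * x + 1)
    square = solve-∀
    double : ∀ x → 2 * x + 2 ≡ 2 * (1 + x)
    double = solve-∀

UV : ℕ → ℕ → ℕ → ℕ
UV α β j = U α β j * V α β j

index<UV : ∀ {α β} → 1 ≤ α → 1 ≤ β → ∀ i → suc i ≤ UV α β (suc (suc i))
index<UV {α} {β} 1≤α 1≤β i = begin
  suc i                              ≤⟨ index≤walk₀ 1≤α 1≤β ≤-refl 1≤α+β·0 (suc i) ⟩
  walk₀ α β 1 (α * 1 + β * 0) (suc i) ≡⟨ walk₀-suc α β 0 1 (suc i) ⟨
  V α β (suc (suc i))                ≤⟨ m≤n*m _ (U α β (suc (suc i))) {{>-nonZero (U-pos {α} {β} {suc (suc i)} 1≤α 1≤β (s≤s (s≤s z≤n)))}} ⟩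
  UV α β (suc (suc i))               ∎
  where
  open ≤-Reasoning
  1≤α+β·0 : 1 ≤ α * 1 + β * 0
  1≤α+β·0 = ≤-trans 1≤α (≤-trans (m≤m*n α 1) (m≤m+n _ _))

n≤n*n : ∀ n → n ≤ n * n
n≤n*n zero = z≤n
n≤n*n (suc n) = m≤m*n (suc n) (suc n)

-- Every pair (α,β) with γ_{α',β'} < γ_{α,β} beats (α',β') eventually, with a threshold that
-- is uniform over all such pairs: inside the box α ≤ A, β ≤ M by Separation, outside it
-- because γ_{α,β} ≥ A = s³.
module Dominance (α' β' : ℕ) (1≤α' : 1 ≤ α') (1≤β' : 1 ≤ β') where

  s = α' + β'
  A = s * s * s
  M = A * A
  B = 8 * (M * M * M)

  1≤s : 1 ≤ s
  1≤s = ≤-trans 1≤α' (m≤m+n α' β')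

  1≤A : 1 ≤ A
  1≤A = *-mono-≤ (*-mono-≤ 1≤s 1≤s) 1≤s

  A≤M : A ≤ M
  A≤M = m≤m*n A A {{>-nonZero 1≤A}}

  s≤M : s ≤ M
  s≤M = ≤-trans (m≤n*m s (s * s) {{>-nonZero (*-mono-≤ 1≤s 1≤s)}}) A≤M

  1≤M : 1 ≤ M
  1≤M = ≤-trans 1≤s s≤M

  1≤B : 1 ≤ B
  1≤B = *-mono-≤ (s≤s (z≤n {7})) (*-mono-≤ (*-mono-≤ 1≤M 1≤M) 1≤M)

  a = proj₁ (least-fraction-above α' β' B 1≤α' 1≤β' 1≤B)

  γ'<a/B : α' * a * B + β' * B * B < a * a
  γ'<a/B = proj₁ (proj₂ (least-fraction-above α' β' B 1≤α' 1≤β' 1≤B))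

  a/B-least : a * a < α' * a * B + β' * B * B + 2 * a
  a/B-least = proj₁ (proj₂ (proj₂ (least-fraction-above α' β' B 1≤α' 1≤β' 1≤B)))

  a≤sB : a ≤ s * B
  a≤sB = proj₁ (proj₂ (proj₂ (proj₂ (least-fraction-above α' β' B 1≤α' 1≤β' 1≤B))))

  1≤a : 1 ≤ a
  1≤a = proj₂ (proj₂ (proj₂ (proj₂ (least-fraction-above α' β' B 1≤α' 1≤β' 1≤B))))

  a₂ = a * (2 * a + 1) + 1
  b₂ = B * (2 * a + 1)

  threshold : ℕ → ℕ
  threshold C = 8 + C * β' + (a * b₂) * (C * β' * a * (a₂ * a₂))

  dominates-in-box : ∀ {α β} → 1 ≤ α → 1 ≤ β → GammaLt (α' , β') (α , β) → α ≤ A → β ≤ M →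
    ∀ C j → threshold C ≤ j → C * UV α' β' (suc j) ≤ UV α β j
  dominates-in-box {α} {β} 1≤α 1≤β (a₀ , b₀ , 1≤b₀ , γ'<a₀/b₀ , a₀/b₀<γ) α≤A β≤M C (suc (suc t)) (s≤s (s≤s th≤t)) = begin
    C * UV α' β' (suc j)                         ≡⟨ cong (λ u → C * (u * V α' β' (suc j))) (U-suc α' β' j) ⟩
    C * (β' * V α' β' j * V α' β' (suc j))       ≡⟨ regroup C β' (V α' β' j) (V α' β' (suc j)) ⟩
    K * (V α' β' j * V α' β' (suc j))            ≤⟨ *-monoˡ-≤ _ (n≤n*n K) ⟩
    K * K * (V α' β' j * V α' β' (suc j))        ≡⟨ interchange K (V α' β' j) (V α' β' (suc j)) ⟩
    (K * V α' β' j) * (K * V α' β' (suc j))      ≤⟨ *-mono-≤ (dominates t (≤-trans T₀≤t (n≤1+n t)))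
                                                             (dominates (suc t) (≤-trans T₀≤t (≤-trans (n≤1+n t) (n≤1+n _)))) ⟩
    V α β (suc t) * V α β j                      ≤⟨ *-monoˡ-≤ (V α β j) (m≤n*m _ β {{>-nonZero 1≤β}}) ⟩
    β * V α β (suc t) * V α β j                  ≡⟨ cong (_* V α β j) (U-suc α β (suc t)) ⟨
    UV α β j                                     ∎
    where
    open ≤-Reasoning
    j = suc (suc t)
    K = C * β'
    T₀≤t : (a * b₂) * (K * a * (a₂ * a₂)) ≤ t
    T₀≤t = ≤-trans (m≤n+m _ (6 + K)) th≤t
    a/B<γ : a * a < α * a * B + β * B * B
    a/B<γ = Separation.separation α' β' α β a₀ b₀ a B M 1≤α' 1≤β' 1≤β (≤-trans α≤A A≤M) β≤M s≤M 1≤b₀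
      γ'<a₀/b₀ a₀/b₀<γ ≤-refl γ'<a/B a/B-least a≤sB
    dominates : ∀ t → (a * b₂) * (K * a * (a₂ * a₂)) ≤ suc t → K * V α' β' (suc (suc t)) ≤ V α β (suc t)
    dominates = V-dominates α' β' α β a B a₂ b₂ K (<⇒≤ γ'<a/B) 1≤a 1≤B
      (fraction-below α β a B a/B<γ) (m≤n+m 1 _) (*-mono-≤ 1≤B (m≤n+m 1 _)) 1≤α (fraction-gap a B 1≤B)
    regroup : ∀ C b x y → C * (b * x * y) ≡ C * b * (x * y)
    regroup = solve-∀
    interchange : ∀ K x y → K * K * (x * y) ≡ (K * x) * (K * y)
    interchange = solve-∀

  outside-box-below : ∀ {α β} → ¬ (α ≤ A × β ≤ M) → A * A ≤ α * A + β
  outside-box-below {α} {β} outside with α ≤? A | β ≤? M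
  ... | no α≰A | _ = ≤-trans (*-monoˡ-≤ A (<⇒≤ (≰⇒> α≰A))) (m≤m+n _ β)
  ... | yes α≤A | yes β≤M = ⊥-elim (outside (α≤A , β≤M))
  ... | yes _ | no β≰M = ≤-trans (<⇒≤ (≰⇒> β≰M)) (m≤n+m β _)

  dominates-outside-box : ∀ {α β} → 1 ≤ α → ¬ (α ≤ A × β ≤ M) →
    ∀ C j → threshold C ≤ j → C * UV α' β' (suc j) ≤ V α β j
  dominates-outside-box {α} {β} 1≤α outside C j th≤j =
    subst (λ i → C * UV α' β' (suc i) ≤ V α β i) (m+[n∸m]≡n 7≤j) (begin
      C * UV α' β' (suc i)                          ≡⟨ cong (λ u → C * (u * V α' β' (suc i))) (U-suc α' β' i) ⟩
      C * (β' * V α' β' i * V α' β' (suc i))        ≡⟨ regroup C β' (V α' β' i) (V α' β' (suc i)) ⟩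
      C * β' * (V α' β' i * V α' β' (suc i))        ≤⟨ V-dominates-large α' β' α β s (C * β') t s-above 2≤s (outside-box-below outside) 1≤α Cβ'≤t ⟩
      V α β i                                       ∎)
    where
    open ≤-Reasoning
    t = j ∸ 7
    i = 7 + t
    7≤j : 7 ≤ j
    7≤j = ≤-trans (m≤m+n 7 _) th≤j
    Cβ'≤t : C * β' ≤ t
    Cβ'≤t = ≤-trans (≤-trans (m≤m+n (C * β') _) (n≤1+n _)) (∸-monoˡ-≤ 7 th≤j)
    2≤s : 2 ≤ s
    2≤s = +-mono-≤ 1≤α' 1≤β'
    s-above : α' * s + β' ≤ s * s
    s-above = ≤-trans (+-monoʳ-≤ (α' * s) (m≤m*n β' s {{>-nonZero 1≤s}})) (≤-reflexive (sym (*-distribʳ-+ s α' β')))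
    regroup : ∀ C b x y → C * (b * x * y) ≡ C * b * (x * y)
    regroup = solve-∀

module Density (T : Pred Pair 0ℓ) (valid : Valid T) (α' β' : ℕ) (Tα'β' : T (α' , β'))
  (γ'-minimal : ∀ α β → T (α , β) → (α , β) ≢ (α' , β') → GammaLt (α' , β') (α , β)) (k : ℕ) where

  1≤α' = proj₁ (valid α' β' Tα'β')
  1≤β' = proj₁ (proj₂ (valid α' β' Tα'β'))

  open Dominance α' β' 1≤α' 1≤β'

  k₂ = 2 * suc k
  L = length (box A M)
  K = k₂ * L
  C = K * k₂
  J = threshold C

  f : ℕ → ℕ
  f j = k₂ * UV α' β' j

  N = f J

  1≤k₂ : 1 ≤ k₂
  1≤k₂ = *-mono-≤ (s≤s (z≤n {1})) (s≤s (z≤n {k}))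

  1≤L : 1 ≤ L
  1≤L = ∈⇒1≤length (∈-box ≤-refl 1≤A ≤-refl 1≤M)

  1≤K : 1 ≤ K
  1≤K = *-mono-≤ 1≤k₂ 1≤L

  n<f[J+n] : ∀ n → n < f (J + n)
  n<f[J+n] n = ≤-trans (s≤s (m≤n+m n _)) (≤-trans (index<UV 1≤α' 1≤β' (J ∸ 2 + n)) (m≤n*m _ k₂ {{>-nonZero 1≤k₂}}))

  1≤N : 1 ≤ N
  1≤N = ≤-trans (s≤s z≤n) (subst (λ i → 0 < f i) (+-identityʳ J) (n<f[J+n] 0))

  module AtScale (n : ℕ) (N≤n : N ≤ n) where

    bracketed = bracket f n n J N≤n (n<f[J+n] n)

    j = proj₁ bracketed

    J≤j : J ≤ j
    J≤j = proj₁ (proj₂ bracketed)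

    fj≤n : f j ≤ n
    fj≤n = proj₁ (proj₂ (proj₂ bracketed))

    n<f[1+j] : n < f (suc j)
    n<f[1+j] = proj₂ (proj₂ (proj₂ bracketed))

    2≤j : 2 ≤ j
    2≤j = ≤-trans (s≤s (s≤s z≤n)) J≤j

    1≤j : 1 ≤ j
    1≤j = ≤-trans (s≤s z≤n) 2≤j

    1≤n : 1 ≤ n
    1≤n = ≤-trans 1≤N N≤n

    -- A pair of the box need not lie in T; the condition K n ≤ U_j V_j, which holds for those
    -- that do, is what makes each Bad q small.
    Bad : Pair → Pred ℕ 0ℓ
    Bad (α , β) m = (K * n ≤ UV α β j) × RepresentableUpTo (U α β j) (V α β j) m

    bad? : ∀ q → Decidable (Bad q)
    bad? (α , β) m = K * n ≤? UV α β j ×-dec representableUpTo? (U α β j) (V α β j) m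

    Exceptional : Pred ℕ 0ℓ
    Exceptional = (_≤ UV α' β' j) ∪ AnyB bad? (box A M)

    exceptional? : Decidable Exceptional
    exceptional? = (_≤? UV α' β' j) ∪? anyB? bad? (box A M)

    late-occurrence⇒exceptional : ∀ {α β m t} → T (α , β) → (α , β) ≢ (α' , β') → m ≤ n →
      Occurs α β m t → suc j ≤ t → Exceptional m
    late-occurrence⇒exceptional {α} {β} {m} Tαβ ≢α'β' m≤n occ j<t = in-or-out (α ≤? A) (β ≤? M)
      where
      1≤α = proj₁ (valid α β Tαβ)
      1≤β = proj₁ (proj₂ (valid α β Tαβ))
      rep : Representable (U α β j) (V α β j) m
      rep = occurs⇒representable j 1≤α occ j<t
      too-far : ¬ (α ≤ A × β ≤ M) → ⊥
      too-far outside = <-irrefl refl (<-≤-trans n<f[1+j] (≤-trans f[1+j]≤V (≤-trans (representable⇒v≤ rep) m≤n)))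
        where
        f[1+j]≤V : f (suc j) ≤ V α β j
        f[1+j]≤V = ≤-trans (*-monoˡ-≤ _ (m≤n*m k₂ K {{>-nonZero 1≤K}})) (dominates-outside-box 1≤α outside C j J≤j)
      in-or-out : Dec (α ≤ A) → Dec (β ≤ M) → Exceptional m
      in-or-out (no α≰A) _ = ⊥-elim (too-far (α≰A ∘ proj₁))
      in-or-out (yes _) (no β≰M) = ⊥-elim (too-far (β≰M ∘ proj₂))
      in-or-out (yes α≤A) (yes β≤M) = inj₂ (lose (∈-box 1≤α α≤A 1≤β β≤M) (Kn≤UV ,
        representable⇒representableUpTo (U-pos 1≤α 1≤β 2≤j) (V-pos 1≤α 1≤j) rep))
        where
        open ≤-Reasoning
        Kn≤UV : K * n ≤ UV α β j
        Kn≤UV = begin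
          K * n                        ≤⟨ *-monoʳ-≤ K (<⇒≤ n<f[1+j]) ⟩
          K * (k₂ * UV α' β' (suc j))  ≡⟨ *-assoc K k₂ _ ⟨
          C * UV α' β' (suc j)         ≤⟨ dominates-in-box 1≤α 1≤β (γ'-minimal α β Tαβ ≢α'β') α≤A β≤M C j J≤j ⟩
          UV α β j                     ∎

    occurs-after-j : ∀ {m} → ¬ m ≤ UV α' β' j → Occurs α' β' m (suc j)
    occurs-after-j m≰UV =
      let x , y , 1≤x , 1≤y , xU+yV≡m = frobenius (coprime-U-V (proj₂ (proj₂ (valid α' β' Tα'β'))) 1≤j)
                                          (U-pos 1≤α' 1≤β' 2≤j) (V-pos 1≤α' 1≤j) (≰⇒> m≰UV)
      in x , y , 1≤x , 1≤y , s≤s z≤n , trans (walk₀≡U+V α' β' x y j) xU+yV≡m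

    unexceptional⇒InE : ∀ {m} → m ≤ n → ¬ Exceptional m → InE T (α' , β') m
    unexceptional⇒InE {m} m≤n ¬exceptional =
      let s , IsS-s , 1+j≤s = IsS-exists 1≤α' 1≤β' (occurs-after-j (¬exceptional ∘ inj₁))
      in Tα'β' , s , IsS-s , λ α β Tαβ ≢α'β' t (occ , _) →
           <-≤-trans (s≤s (≮⇒≥ (¬exceptional ∘ late-occurrence⇒exceptional Tαβ ≢α'β' m≤n occ))) 1+j≤s

    count-bad : ∀ q → count (bad? q) (range n) * K ≤ n
    count-bad (α , β) = by-dominance (K * n ≤? UV α β j)
      where
      open ≤-Reasoning
      c = count (bad? (α , β)) (range n)
      by-dominance : Dec (K * n ≤ UV α β j) → c * K ≤ n
      by-dominance (no Kn≰UV) =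
        subst (λ c → c * K ≤ n) (sym (count-none (bad? (α , β)) (λ m → Kn≰UV ∘ proj₁) (range n))) z≤n
      by-dominance (yes Kn≤UV) = *-cancelʳ-≤ (c * K) n n {{>-nonZero 1≤n}} (begin
        c * K * n           ≡⟨ *-assoc c K n ⟩
        c * (K * n)         ≤⟨ *-monoʳ-≤ c Kn≤UV ⟩
        c * UV α β j        ≤⟨ count-representable (bad? (α , β)) (U α β j) (V α β j) n {{>-nonZero 1≤U}} {{>-nonZero 1≤V}}
                                 (λ m → representableUpTo⇒representable ∘ proj₂) ⟩
        n * n               ∎)
        where
        1≤UV = ≤-trans (*-mono-≤ 1≤K 1≤n) Kn≤UV
        1≤U = 1≤m*n⇒1≤m (U α β j) (V α β j) 1≤UV
        1≤V = 1≤m*n⇒1≤m (V α β j) (U α β j) (subst (1 ≤_) (*-comm (U α β j) (V α β j)) 1≤UV)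

    count-exceptional : k₂ * count exceptional? (range n) ≤ n + n
    count-exceptional = begin
      k₂ * count exceptional? (range n)      ≤⟨ *-monoʳ-≤ k₂ (count-∪ low? any-bad? (range n)) ⟩
      k₂ * (count low? (range n) + count any-bad? (range n))
                                             ≡⟨ *-distribˡ-+ k₂ (count low? (range n)) _ ⟩
      k₂ * count low? (range n) + k₂ * count any-bad? (range n)
                                             ≤⟨ +-mono-≤ low-bound any-bad-bound ⟩
      n + n                                  ∎
      where
      open ≤-Reasoning
      low? = _≤? UV α' β' j
      any-bad? = anyB? bad? (box A M)
      low-bound : k₂ * count low? (range n) ≤ n
      low-bound = ≤-trans (*-monoʳ-≤ k₂ (count-≤-range low? n (UV α' β' j) (λ _ m≤ → m≤))) fj≤n
      any-bad-bound : k₂ * count any-bad? (range n) ≤ n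
      any-bad-bound = *-cancelʳ-≤ _ n L {{>-nonZero 1≤L}} (begin
        k₂ * count any-bad? (range n) * L    ≡⟨ regroup k₂ (count any-bad? (range n)) L ⟩
        count any-bad? (range n) * K         ≤⟨ count-anyB bad? (box A M) K n (range n) count-bad ⟩
        L * n                                ≡⟨ *-comm L n ⟩
        n * L                                ∎)
        where
        regroup : ∀ k c L → k * c * L ≡ c * (k * L)
        regroup = solve-∀

    unexceptional = filter (∁? exceptional?) (range n)

    dense : Σ (List ℕ) λ xs → Unique xs × All (λ m → (1 ≤ m) × (m ≤ n) × InE T (α' , β') m) xs ×
      (suc k * n ≤ n + suc k * length xs)
    dense = unexceptional , filter⁺ (∁? exceptional?) (range-unique n) , tabulate in-E , *-cancelˡ-≤ 2 (begin
      2 * (suc k * n)                         ≡⟨ *-assoc 2 (suc k) n ⟨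
      k₂ * n                                  ≤⟨ *-monoʳ-≤ k₂ (subst (_≤ length unexceptional + count exceptional? (range n)) (length-range n)
                                                   (length≤count+count (∁? exceptional?) exceptional? (λ m → decidable-stable (exceptional? m)) (range n))) ⟩
      k₂ * (length unexceptional + count exceptional? (range n))
                                              ≡⟨ *-distribˡ-+ k₂ (length unexceptional) _ ⟩
      k₂ * length unexceptional + k₂ * count exceptional? (range n)
                                              ≤⟨ +-monoʳ-≤ (k₂ * length unexceptional) count-exceptional ⟩
      k₂ * length unexceptional + (n + n)     ≡⟨ regroup k (length unexceptional) n ⟩
      2 * (n + suc k * length unexceptional)  ∎)
      where
      open ≤-Reasoning
      regroup : ∀ k l n → 2 * (1 + k) * l + (n + n) ≡ 2 * (n + (1 + k) * l)
      regroup = solve-∀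
      in-E : ∀ {m} → m ∈ unexceptional → (1 ≤ m) × (m ≤ n) × InE T (α' , β') m
      in-E m∈ =
        let m∈range , ¬exceptional = ∈-filter⁻ (∁? exceptional?) {xs = range n} m∈
            1≤m , m≤n = ∈-range⁻ m∈range
        in 1≤m , m≤n , unexceptional⇒InE m≤n ¬exceptional

corollary6 : (T : Pred Pair 0ℓ) → Valid T → (α' β' : ℕ) → T (α' , β') →
    (∀ α β → T (α , β) → (α , β) ≢ (α' , β') → GammaLt (α' , β') (α , β)) →
    DensityOne (InE T (α' , β'))
corollary6 T valid α' β' Tα'β' γ'-minimal k = N , AtScale.dense
  where open Density T valid α' β' Tα'β' γ'-minimal k
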